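{- Let $r$ be a positive integer, let $\omega = e^{2\pi i/r}$, and let $x$ be a complex number with $0<|x|<1$ (or a formal variable), with $q = x^r$. If $r$ is an odd prime, then $$\prod_{k=0}^{r-1}\prod_{n=1}^{\infty}\frac{1+(\omega^k x)^n}{1-(\omega^k x)^n} = \frac{(q^2;q^2)_\infty^{r+1}(q^r;q^r)_\infty^2}{(q)_\infty^{2r+2}(q^{2r};q^{2r})_\infty},$$ and if $r = 2^p$ for some integer $p\ge 0$, then $$\prod_{k=0}^{r-1}\prod_{n=1}^{\infty}\frac{1+(\omega^k x)^n}{1-(\omega^k x)^n} = \frac{(q^2;q^2)_\infty^{r}}{(q)_\infty^{2r}}.$$
   Context: Notation: $(a;q)_\infty = \prod_{i\ge0}(1-aq^i)$ and $(q)_\infty = (q;q)_\infty$. -}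

module Defs where

open import Level using (_⊔_)
open import Data.Nat as ℕ using (ℕ; zero; suc)
open import Data.Nat.Divisibility using (_∣?_)
open import Relation.Nullary.Decidable using (does)
open import Data.Bool using (if_then_else_)
open import Algebra.Bundles using (CommutativeRing)

-- Formal power series in one variable x over a commutative ring R,
-- represented by their coefficient sequences.
module PS {c ℓ} (R : CommutativeRing c ℓ) where
  open CommutativeRing R

  Series : Set c
  Series = ℕ → Carrier

  pow : Carrier → ℕ → Carrier
  pow a zero    = 1#
  pow a (suc n) = a * pow a n

  sumTo : ℕ → (ℕ → Carrier) → Carrier
  sumTo zero    f = 0#
  sumTo (suc n) f = sumTo n f + f n

  one : Series
  one zero    = 1#
  one (suc _) = 0#

  _⊛_ : Series → Series → Series
  (a ⊛ b) n = sumTo (suc n) (λ i → a i * b (n ℕ.∸ i))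

  infixl 7 _⊛_

  _^ˢ_ : Series → ℕ → Series
  f ^ˢ zero  = one
  f ^ˢ suc m = f ⊛ (f ^ˢ m)

  prodFin : ℕ → (ℕ → Series) → Series
  prodFin zero    f = one
  prodFin (suc n) f = prodFin n f ⊛ f n

  prodTo : (ℕ → Series) → ℕ → Series
  prodTo f zero    = one
  prodTo f (suc m) = prodTo f m ⊛ f (suc m)

  -- Infinite product Π_{n≥1} f n, for factors with f n ≡ 1 mod x^n
  -- (which holds for every use below): the coefficient of x^N is that of
  -- the partial product Π_{n=1}^{N} f n.
  prodInf : (ℕ → Series) → Series
  prodInf f N = prodTo f N N

  -- 1 + (y x)^n   (n ≥ 1)
  onePlus : Carrier → ℕ → Series
  onePlus y n i =
    if does (i ℕ.≟ 0) then 1# else (if does (i ℕ.≟ n) then pow y n else 0#)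

  -- 1 - (y x)^n   (n ≥ 1)
  oneMinus : Carrier → ℕ → Series
  oneMinus y n i =
    if does (i ℕ.≟ 0) then 1# else (if does (i ℕ.≟ n) then - pow y n else 0#)

  -- 1 / (1 - (y x)^n) = Σ_{j≥0} (y x)^{n j}   (n ≥ 1)
  invOneMinus : Carrier → ℕ → Series
  invOneMinus y n i = if does (n ∣? i) then pow y i else 0#

  -- (x^m ; x^m)_∞ = Π_{n≥1} (1 - x^{m n})
  poch : ℕ → Series
  poch m = prodInf (λ n → oneMinus 1# (m ℕ.* n))

  -- 1 / (x^m ; x^m)_∞ = Π_{n≥1} 1/(1 - x^{m n})
  pochInv : ℕ → Series
  pochInv m = prodInf (λ n → invOneMinus 1# (m ℕ.* n))

  lhs : ℕ → Carrier → Series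
  lhs r ω = prodFin r (λ k →
              prodInf (λ n → onePlus (pow ω k) n ⊛ invOneMinus (pow ω k) n))

  _≈ˢ_ : Series → Series → Set ℓ
  f ≈ˢ g = ∀ N → f N ≈ g N

  -- ω is a root of the r-th cyclotomic polynomial, r an odd prime:
  -- Φ_r(ω) = 1 + ω + ... + ω^{r-1} = 0
  CycRootPrime : ℕ → Carrier → Set ℓ
  CycRootPrime r ω = sumTo r (pow ω) ≈ 0#

  -- ω is a root of Φ_{2^p}:  Φ_1(t) = t - 1,  Φ_{2^{p+1}}(t) = t^{2^p} + 1
  CycRootPow2 : ℕ → Carrier → Set ℓ
  CycRootPow2 zero    ω = ω ≈ 1#
  CycRootPow2 (suc p) ω = pow ω (2 ℕ.^ p) ≈ - 1#

module Submission where

-- Write ζ = ω^n.  The n-th factors of the product over k are Π_k (1 ± ζ^k xⁿ).  If r ∣ n they are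
-- (1 ± xⁿ)^r.  If r is an odd prime and r ∤ n, then ζ is again a root of [r]_ζ = 1 + ζ + ⋯ + ζ^(r−1);
-- as every [i]_ζ with 0 < i < r is then invertible, the Gaussian binomials [r choose i]_ζ vanish and
-- Π_k (1 ± ζ^k xⁿ) = 1 ± x^(rn).  If r = 2^p and r ∤ n, some power of ζ is −1, so {ζ^k} is closed
-- under negation and numerator and denominator cancel.  Splitting Π_{n≥1} into the n with r ∤ n and
-- the multiples of r, and writing (1 + x^j)/(1 − x^j) = (1 − x^(2j))/(1 − x^j)², gives the
-- q-Pochhammer forms.

open import Defs
open import Algebra.Bundles using (CommutativeRing; CommutativeMonoid)
open import Relation.Binary.Bundles using (Setoid)
open import Relation.Binary.Structures using (IsEquivalence)
open import Data.Nat as ℕ using (ℕ; zero; suc; _<_; _≤_; _∸_; _^_; z≤n; s≤s)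
import Data.Nat.Properties as ℕP
open import Data.Nat.Divisibility
  using (_∣_; _∣?_; divides; ∣⇒≤; ∣m+n∣m⇒∣n; ∣m∣n⇒∣m+n; m∣m*n; n∣m*n; ∣-refl; _∣0; 1∣_; *-monoˡ-∣)
open import Data.Nat.Primality using (Prime; prime⇒irreducible; prime⇒nonZero; prime[2])
open import Data.Nat.Coprimality using (Coprime; coprime-Bézout)
open import Data.Nat.GCD using (module Bézout)
open import Data.Product using (∃-syntax; _,_)
open import Data.Sum using (_⊎_; inj₁; inj₂)
open import Relation.Nullary using (¬_; Dec; yes; no; does; contradiction)
open import Relation.Nullary.Decidable using (dec-true; dec-false)
open import Data.Bool using (true; false; if_then_else_)
open import Function using (_∘_)
open import Data.Nat.Tactic.RingSolver using (solve-∀)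
open import Relation.Binary.PropositionalEquality as ≡ using (_≡_; _≢_)
import Relation.Binary.Reasoning.Setoid as SetoidReasoning
open import Relation.Binary.Definitions using (tri<; tri≈; tri>)

module PowerSeriesProducts {c ℓ} (R : CommutativeRing c ℓ) where

  open CommutativeRing R
  open PS R
  open import Algebra.Definitions _≈_ using (LeftInvertible)
  open import Algebra.Properties.Ring ring using (-‿distribˡ-*; -‿distribʳ-*; -1*x≈-x; -‿involutive; +-inverseˡ-unique)
  open import Algebra.Properties.CommutativeSemigroup +-commutativeSemigroup
    using () renaming (interchange to +-interchange)
  open import Algebra.Solver.Ring.NaturalCoefficients.Default commutativeSemiring using (solve; _:=_; _:+_; _:*_; con)

  module ≈-Reasoning = SetoidReasoning setoid

  pow-cong : ∀ n {a b} → a ≈ b → pow a n ≈ pow b n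
  pow-cong zero    a≈b = refl
  pow-cong (suc n) a≈b = *-cong a≈b (pow-cong n a≈b)

  pow-+ : ∀ a m n → pow a (m ℕ.+ n) ≈ pow a m * pow a n
  pow-+ a zero    n = sym (*-identityˡ _)
  pow-+ a (suc m) n = trans (*-congˡ (pow-+ a m n)) (sym (*-assoc a _ _))

  pow-* : ∀ a m n → pow a (m ℕ.* n) ≈ pow (pow a m) n
  pow-* a m zero    = reflexive (≡.cong (pow a) (ℕP.*-zeroʳ m))
  pow-* a m (suc n) = begin
    pow a (m ℕ.* suc n)       ≡⟨ ≡.cong (pow a) (ℕP.*-suc m n) ⟩
    pow a (m ℕ.+ m ℕ.* n)     ≈⟨ pow-+ a m (m ℕ.* n) ⟩
    pow a m * pow a (m ℕ.* n) ≈⟨ *-congˡ (pow-* a m n) ⟩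
    pow a m * pow (pow a m) n ∎
    where open ≈-Reasoning

  pow-comm : ∀ a m n → pow (pow a m) n ≈ pow (pow a n) m
  pow-comm a m n = trans (sym (pow-* a m n)) (trans (reflexive (≡.cong (pow a) (ℕP.*-comm m n))) (pow-* a n m))

  pow-1# : ∀ n → pow 1# n ≈ 1#
  pow-1# zero    = refl
  pow-1# (suc n) = trans (*-identityˡ _) (pow-1# n)

  pow-root-of-unity : ∀ {a r} → pow a r ≈ 1# → ∀ q → pow a (r ℕ.* q) ≈ 1#
  pow-root-of-unity {a} {r} aʳ≈1 q = trans (pow-* a r q) (trans (pow-cong q aʳ≈1) (pow-1# q))

  pow-neg-one-even : ∀ m → pow (- 1#) (2 ℕ.* m) ≈ 1#
  pow-neg-one-even m = pow-root-of-unity { - 1#} {2} square m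
    where
    square : pow (- 1#) 2 ≈ 1#
    square = trans (*-congˡ (*-identityʳ (- 1#))) (trans (-1*x≈-x (- 1#)) (-‿involutive 1#))

  pow-neg-one-odd : ∀ m → pow (- 1#) (suc (2 ℕ.* m)) ≈ - 1#
  pow-neg-one-odd m = trans (*-congˡ (pow-neg-one-even m)) (*-identityʳ (- 1#))

  pow-2^-root : ∀ {ω} q → pow ω (2 ^ q) ≈ - 1# → pow ω (2 ^ suc q) ≈ 1#
  pow-2^-root {ω} q ω²ᑫ≈-1 = begin
    pow ω (2 ℕ.* 2 ^ q)        ≡⟨ ≡.cong (pow ω) (ℕP.*-comm 2 (2 ^ q)) ⟩
    pow ω (2 ^ q ℕ.* 2)        ≈⟨ pow-* ω (2 ^ q) 2 ⟩
    pow (pow ω (2 ^ q)) 2      ≈⟨ pow-cong 2 ω²ᑫ≈-1 ⟩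
    pow (- 1#) 2               ≈⟨ pow-neg-one-even 1 ⟩
    1#                         ∎
    where open ≈-Reasoning

  sumTo-cong : ∀ n {f g} → (∀ i → i < n → f i ≈ g i) → sumTo n f ≈ sumTo n g
  sumTo-cong zero    f≈g = refl
  sumTo-cong (suc n) f≈g = +-cong (sumTo-cong n (λ i i<n → f≈g i (ℕP.m<n⇒m<1+n i<n))) (f≈g n ℕP.≤-refl)

  sumTo-cong′ : ∀ n {f g} → (∀ i → f i ≈ g i) → sumTo n f ≈ sumTo n g
  sumTo-cong′ n f≈g = sumTo-cong n (λ i _ → f≈g i)

  sumTo-zero : ∀ n {f} → (∀ i → i < n → f i ≈ 0#) → sumTo n f ≈ 0#
  sumTo-zero n {f} f≈0 = trans (sumTo-cong n f≈0) (zeros n)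
    where
    zeros : ∀ n → sumTo n (λ _ → 0#) ≈ 0#
    zeros zero    = refl
    zeros (suc n) = trans (+-identityʳ _) (zeros n)

  sumTo-+ : ∀ n f g → sumTo n (λ i → f i + g i) ≈ sumTo n f + sumTo n g
  sumTo-+ zero    f g = sym (+-identityˡ 0#)
  sumTo-+ (suc n) f g = trans (+-congʳ (sumTo-+ n f g)) (+-interchange _ _ _ _)

  sumTo-distribˡ : ∀ n a f → a * sumTo n f ≈ sumTo n (λ i → a * f i)
  sumTo-distribˡ zero    a f = zeroʳ a
  sumTo-distribˡ (suc n) a f = trans (distribˡ a _ _) (+-congʳ (sumTo-distribˡ n a f))

  sumTo-distribʳ : ∀ n a f → sumTo n f * a ≈ sumTo n (λ i → f i * a)
  sumTo-distribʳ n a f = trans (*-comm _ a) (trans (sumTo-distribˡ n a f) (sumTo-cong′ n (λ i → *-comm a (f i))))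

  sumTo-unconsˡ : ∀ n f → sumTo (suc n) f ≈ f 0 + sumTo n (λ i → f (suc i))
  sumTo-unconsˡ zero    f = trans (+-identityˡ _) (sym (+-identityʳ _))
  sumTo-unconsˡ (suc n) f = trans (+-congʳ (sumTo-unconsˡ n f)) (+-assoc _ _ _)

  sumTo-split : ∀ m n f → sumTo (m ℕ.+ n) f ≈ sumTo m f + sumTo n (λ i → f (m ℕ.+ i))
  sumTo-split m zero    f = trans (reflexive (≡.cong (λ k → sumTo k f) (ℕP.+-identityʳ m))) (sym (+-identityʳ _))
  sumTo-split m (suc n) f = begin
    sumTo (m ℕ.+ suc n) f                                     ≡⟨ ≡.cong (λ k → sumTo k f) (ℕP.+-suc m n) ⟩
    sumTo (m ℕ.+ n) f + f (m ℕ.+ n)                           ≈⟨ +-congʳ (sumTo-split m n f) ⟩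
    (sumTo m f + sumTo n (λ i → f (m ℕ.+ i))) + f (m ℕ.+ n)   ≈⟨ +-assoc _ _ _ ⟩
    sumTo m f + sumTo (suc n) (λ i → f (m ℕ.+ i))             ∎
    where open ≈-Reasoning

  sumTo-reverse : ∀ n f → sumTo (suc n) f ≈ sumTo (suc n) (λ i → f (n ∸ i))
  sumTo-reverse zero    f = refl
  sumTo-reverse (suc n) f = begin
    sumTo (suc n) f + f (suc n)                        ≈⟨ +-congʳ (sumTo-reverse n f) ⟩
    sumTo (suc n) (λ i → f (n ∸ i)) + f (suc n)        ≈⟨ +-comm _ _ ⟩
    f (suc n) + sumTo (suc n) (λ i → f (n ∸ i))        ≈⟨ sumTo-unconsˡ (suc n) (λ i → f (suc n ∸ i)) ⟨
    sumTo (suc (suc n)) (λ i → f (suc n ∸ i))          ∎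
    where open ≈-Reasoning

  sumTo-single : ∀ n p f → p < n → (∀ i → i < n → i ≢ p → f i ≈ 0#) → sumTo n f ≈ f p
  sumTo-single (suc n) p f p<1+n others with p ℕ.≟ n
  ... | yes ≡.refl = trans (+-congʳ (sumTo-zero n (λ i i<n → others i (ℕP.m<n⇒m<1+n i<n) (ℕP.<⇒≢ i<n))))
                           (+-identityˡ _)
  ... | no  p≢n    = trans (+-cong (sumTo-single n p f (ℕP.≤∧≢⇒< (ℕP.≤-pred p<1+n) p≢n)
                                      (λ i i<n → others i (ℕP.m<n⇒m<1+n i<n)))
                                   (others n ℕP.≤-refl (p≢n ∘ ≡.sym)))
                           (+-identityʳ _)

  sumTo-triangle : ∀ n (g : ℕ → ℕ → Carrier) →
    sumTo (suc n) (λ i → sumTo (suc i) (λ j → g j i)) ≈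
    sumTo (suc n) (λ j → sumTo (suc (n ∸ j)) (λ k → g j (j ℕ.+ k)))
  sumTo-triangle zero    g = refl
  sumTo-triangle (suc n) g = begin
    sumTo (suc n) (λ i → sumTo (suc i) (λ j → g j i)) + sumTo (suc (suc n)) (λ j → g j (suc n))
      ≈⟨ +-congʳ (sumTo-triangle n g) ⟩
    sumTo (suc n) row + (sumTo (suc n) (λ j → g j (suc n)) + g (suc n) (suc n))
      ≈⟨ +-assoc _ _ _ ⟨
    (sumTo (suc n) row + sumTo (suc n) (λ j → g j (suc n))) + g (suc n) (suc n)
      ≈⟨ +-congʳ (sumTo-+ (suc n) row (λ j → g j (suc n))) ⟨
    sumTo (suc n) (λ j → row j + g j (suc n)) + g (suc n) (suc n)
      ≈⟨ +-cong (sumTo-cong (suc n) row-extend) last-row ⟩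
    sumTo (suc (suc n)) (λ j → sumTo (suc (suc n ∸ j)) (λ k → g j (j ℕ.+ k)))
      ∎
    where
    open ≈-Reasoning
    row : ℕ → Carrier
    row j = sumTo (suc (n ∸ j)) (λ k → g j (j ℕ.+ k))
    row-extend : ∀ j → j < suc n → row j + g j (suc n) ≈ sumTo (suc (suc n ∸ j)) (λ k → g j (j ℕ.+ k))
    row-extend j j<1+n rewrite ℕP.+-∸-assoc 1 (ℕP.≤-pred j<1+n) = reflexive (≡.cong (λ t → row j + g j t) (≡.sym
      (≡.trans (ℕP.+-suc j (n ∸ j)) (≡.cong suc (ℕP.m+[n∸m]≡n (ℕP.≤-pred j<1+n))))))
    last-row : g (suc n) (suc n) ≈ sumTo (suc (suc n ∸ suc n)) (λ k → g (suc n) (suc n ℕ.+ k))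
    last-row rewrite ℕP.n∸n≡0 n | ℕP.+-identityʳ n = sym (+-identityˡ _)

  -- geom z n = [n]_z = 1 + z + ⋯ + z^(n−1), so CycRootPrime r ω is geom ω r ≈ 0#.

  geom : Carrier → ℕ → Carrier
  geom z n = sumTo n (pow z)

  geom-+ : ∀ z a b → geom z (a ℕ.+ b) ≈ geom z a + pow z a * geom z b
  geom-+ z a b = trans (sumTo-split a b (pow z))
    (+-congˡ (trans (sumTo-cong′ b (pow-+ z a)) (sym (sumTo-distribˡ b (pow z a) (pow z)))))

  geom-suc : ∀ z b → geom z (suc b) ≈ 1# + z * geom z b
  geom-suc z b = trans (geom-+ z 1 b) (+-cong (+-identityˡ 1#) (*-congʳ (*-identityʳ z)))

  geom-* : ∀ z a b → geom z (b ℕ.* a) ≈ geom z a * geom (pow z a) b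
  geom-* z a zero    = sym (zeroʳ _)
  geom-* z a (suc b) = begin
    geom z (a ℕ.+ b ℕ.* a)                            ≈⟨ geom-+ z a (b ℕ.* a) ⟩
    geom z a + pow z a * geom z (b ℕ.* a)             ≈⟨ +-congˡ (*-congˡ (geom-* z a b)) ⟩
    geom z a + pow z a * (geom z a * geom (pow z a) b)
      ≈⟨ solve 3 (λ x w y → x :+ w :* (x :* y) := x :* (con 1 :+ w :* y)) refl (geom z a) (pow z a) (geom (pow z a) b) ⟩
    geom z a * (1# + pow z a * geom (pow z a) b)      ≈⟨ *-congˡ (geom-suc (pow z a) b) ⟨
    geom z a * geom (pow z a) (suc b)                 ∎
    where open ≈-Reasoning

  geom-multiple : ∀ {z r} → geom z r ≈ 0# → ∀ q → geom z (q ℕ.* r) ≈ 0#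
  geom-multiple {z} {r} [r]≈0 q = trans (geom-* z r q) (trans (*-congʳ [r]≈0) (zeroˡ _))

  geom≈0⇒pow≈1 : ∀ {z r} → geom z r ≈ 0# → pow z r ≈ 1#
  geom≈0⇒pow≈1 {z} {r} [r]≈0 = begin
    pow z r              ≈⟨ +-identityˡ _ ⟨
    0# + pow z r         ≈⟨ +-congʳ [r]≈0 ⟨
    geom z (suc r)       ≈⟨ geom-suc z r ⟩
    1# + z * geom z r    ≈⟨ +-congˡ (trans (*-congˡ [r]≈0) (zeroʳ z)) ⟩
    1# + 0#              ≈⟨ +-identityʳ 1# ⟩
    1#                   ∎
    where open ≈-Reasoning

  invertible-cancel : ∀ {q x} → LeftInvertible 1# _*_ q → q * x ≈ 0# → x ≈ 0#
  invertible-cancel {q} {x} (u , uq≈1) qx≈0 = begin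
    x              ≈⟨ *-identityˡ x ⟨
    1# * x         ≈⟨ *-congʳ uq≈1 ⟨
    (u * q) * x    ≈⟨ *-assoc u q x ⟩
    u * (q * x)    ≈⟨ *-congˡ qx≈0 ⟩
    u * 0#         ≈⟨ zeroʳ u ⟩
    0#             ∎
    where open ≈-Reasoning

  prime⇒pos : ∀ {r} → Prime r → 0 < r
  prime⇒pos {r} pr = ℕ.>-nonZero⁻¹ r {{prime⇒nonZero pr}}

  prime∤⇒coprime : ∀ {r k} → Prime r → ¬ r ∣ k → Coprime r k
  prime∤⇒coprime pr r∤k (d∣r , d∣k) with prime⇒irreducible pr d∣r
  ... | inj₁ d≡1    = d≡1
  ... | inj₂ ≡.refl = contradiction d∣k r∤k

  -- Bézout gives 1 + y k = x r or 1 + x r = y k.  Since [k]_z [y]_(z^k) = [y k]_z and [x r]_z ≈ 0, either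
  -- 1 + z [y k]_z ≈ 0 or [y k]_z ≈ 1 + z [x r]_z ≈ 1.
  geom-invertible : ∀ {z r k} → Prime r → geom z r ≈ 0# → ¬ r ∣ k → LeftInvertible 1# _*_ (geom z k)
  geom-invertible {z} {r} {k} pr [r]≈0 r∤k with coprime-Bézout (prime∤⇒coprime pr r∤k)
  ... | Bézout.+- x y eq = - (z * geom (pow z k) y) , (begin
    - (z * geom (pow z k) y) * geom z k
      ≈⟨ -‿distribˡ-* _ _ ⟨
    - (z * geom (pow z k) y * geom z k)
      ≈⟨ -‿cong (solve 3 (λ a b d → a :* b :* d := a :* (d :* b)) refl z _ _) ⟩
    - (z * (geom z k * geom (pow z k) y))
      ≈⟨ -‿cong (*-congˡ (geom-* z k y)) ⟨
    - (z * geom z (y ℕ.* k))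
      ≈⟨ +-inverseˡ-unique 1# _ 1+z[yk]≈0 ⟨
    1#
      ∎)
    where
    open ≈-Reasoning
    1+z[yk]≈0 : 1# + z * geom z (y ℕ.* k) ≈ 0#
    1+z[yk]≈0 = begin
      1# + z * geom z (y ℕ.* k)   ≈⟨ geom-suc z (y ℕ.* k) ⟨
      geom z (1 ℕ.+ y ℕ.* k)      ≡⟨ ≡.cong (geom z) eq ⟩
      geom z (x ℕ.* r)            ≈⟨ geom-multiple [r]≈0 x ⟩
      0#                          ∎
  ... | Bézout.-+ x y eq = geom (pow z k) y , (begin
    geom (pow z k) y * geom z k        ≈⟨ *-comm _ _ ⟩
    geom z k * geom (pow z k) y        ≈⟨ geom-* z k y ⟨
    geom z (y ℕ.* k)                   ≡⟨ ≡.cong (geom z) eq ⟨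
    geom z (1 ℕ.+ x ℕ.* r)             ≈⟨ geom-suc z (x ℕ.* r) ⟩
    1# + z * geom z (x ℕ.* r)          ≈⟨ +-congˡ (trans (*-congˡ (geom-multiple [r]≈0 x)) (zeroʳ z)) ⟩
    1# + 0#                            ≈⟨ +-identityʳ 1# ⟩
    1#                                 ∎)
    where open ≈-Reasoning

  geom-pow-root : ∀ {z r} n → Prime r → geom z r ≈ 0# → ¬ r ∣ n → geom (pow z n) r ≈ 0#
  geom-pow-root {z} {r} n pr [r]≈0 r∤n = invertible-cancel (geom-invertible pr [r]≈0 r∤n) (begin
    geom z n * geom (pow z n) r   ≈⟨ geom-* z n r ⟨
    geom z (r ℕ.* n)              ≡⟨ ≡.cong (geom z) (ℕP.*-comm r n) ⟩
    geom z (n ℕ.* r)              ≈⟨ geom-multiple [r]≈0 n ⟩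
    0#                            ∎)
    where open ≈-Reasoning

  -- Formal power series

  -- A record rather than ∀ N → f N ≈ g N, so that f and g can be inferred from a proof.
  infix 4 _≋_
  record _≋_ (f g : Series) : Set ℓ where
    constructor mk≋
    field coeff : ∀ N → f N ≈ g N
  open _≋_ public

  ≋-refl : ∀ {f} → f ≋ f
  ≋-refl = mk≋ (λ _ → refl)

  ≋-sym : ∀ {f g} → f ≋ g → g ≋ f
  ≋-sym f≋g = mk≋ (λ N → sym (coeff f≋g N))

  ≋-trans : ∀ {f g h} → f ≋ g → g ≋ h → f ≋ h
  ≋-trans f≋g g≋h = mk≋ (λ N → trans (coeff f≋g N) (coeff g≋h N))

  ≡⇒≋ : ∀ {f g} → f ≡ g → f ≋ g
  ≡⇒≋ ≡.refl = ≋-refl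

  ≋-isEquivalence : IsEquivalence _≋_
  ≋-isEquivalence = record { refl = ≋-refl ; sym = ≋-sym ; trans = ≋-trans }

  ≋-setoid : Setoid c ℓ
  ≋-setoid = record { isEquivalence = ≋-isEquivalence }

  module ≋-Reasoning = SetoidReasoning ≋-setoid

  one-pos : ∀ {m} → 0 < m → one m ≈ 0#
  one-pos {suc m} _ = refl

  ⊛-cong : ∀ {a a′ b b′} → a ≋ a′ → b ≋ b′ → a ⊛ b ≋ a′ ⊛ b′
  ⊛-cong a≋a′ b≋b′ = mk≋ (λ N → sumTo-cong′ (suc N) (λ i → *-cong (coeff a≋a′ i) (coeff b≋b′ (N ∸ i))))

  ⊛-congˡ : ∀ a {b b′} → b ≋ b′ → a ⊛ b ≋ a ⊛ b′
  ⊛-congˡ a = ⊛-cong (≋-refl {a})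

  ⊛-congʳ : ∀ b {a a′} → a ≋ a′ → a ⊛ b ≋ a′ ⊛ b
  ⊛-congʳ b a≋a′ = ⊛-cong a≋a′ (≋-refl {b})

  ⊛-comm : ∀ a b → a ⊛ b ≋ b ⊛ a
  ⊛-comm a b = mk≋ λ N → begin
    sumTo (suc N) (λ i → a i * b (N ∸ i))               ≈⟨ sumTo-reverse N _ ⟩
    sumTo (suc N) (λ i → a (N ∸ i) * b (N ∸ (N ∸ i)))   ≈⟨ sumTo-cong (suc N) (λ i i≤N →
      trans (*-comm _ _) (*-congʳ (reflexive (≡.cong b (ℕP.m∸[m∸n]≡n (ℕP.≤-pred i≤N)))))) ⟩
    sumTo (suc N) (λ i → b i * a (N ∸ i))               ∎
    where open ≈-Reasoning

  ⊛-identityʳ : ∀ a → a ⊛ one ≋ a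
  ⊛-identityʳ a = mk≋ λ N → begin
    sumTo (suc N) (λ i → a i * one (N ∸ i))   ≈⟨ sumTo-single (suc N) N _ ℕP.≤-refl (λ i i≤N i≢N →
      trans (*-congˡ (one-pos (ℕP.m<n⇒0<n∸m (ℕP.≤∧≢⇒< (ℕP.≤-pred i≤N) i≢N)))) (zeroʳ _)) ⟩
    a N * one (N ∸ N)                         ≡⟨ ≡.cong (λ t → a N * one t) (ℕP.n∸n≡0 N) ⟩
    a N * 1#                                  ≈⟨ *-identityʳ _ ⟩
    a N                                       ∎
    where open ≈-Reasoning

  ⊛-identityˡ : ∀ a → one ⊛ a ≋ a
  ⊛-identityˡ a = ≋-trans (⊛-comm one a) (⊛-identityʳ a)

  ⊛-assoc : ∀ a b d → (a ⊛ b) ⊛ d ≋ a ⊛ (b ⊛ d)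
  ⊛-assoc a b d = mk≋ λ N → begin
    sumTo (suc N) (λ i → sumTo (suc i) (λ j → a j * b (i ∸ j)) * d (N ∸ i))
      ≈⟨ sumTo-cong′ (suc N) (λ i → sumTo-distribʳ (suc i) (d (N ∸ i)) _) ⟩
    sumTo (suc N) (λ i → sumTo (suc i) (λ j → a j * b (i ∸ j) * d (N ∸ i)))
      ≈⟨ sumTo-triangle N (λ j i → a j * b (i ∸ j) * d (N ∸ i)) ⟩
    sumTo (suc N) (λ j → sumTo (suc (N ∸ j)) (λ k → a j * b ((j ℕ.+ k) ∸ j) * d (N ∸ (j ℕ.+ k))))
      ≈⟨ sumTo-cong′ (suc N) (λ j → sumTo-cong′ (suc (N ∸ j)) (λ k →
           trans (*-assoc _ _ _) (*-congˡ (*-cong (reflexive (≡.cong b (ℕP.m+n∸m≡n j k)))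
                                                  (reflexive (≡.cong d (≡.sym (ℕP.∸-+-assoc N j k)))))))) ⟩
    sumTo (suc N) (λ j → sumTo (suc (N ∸ j)) (λ k → a j * (b k * d ((N ∸ j) ∸ k))))
      ≈⟨ sumTo-cong′ (suc N) (λ j → sumTo-distribˡ (suc (N ∸ j)) (a j) _) ⟨
    sumTo (suc N) (λ j → a j * (b ⊛ d) (N ∸ j))
      ∎
    where open ≈-Reasoning

  seriesMonoid : CommutativeMonoid c ℓ
  seriesMonoid = record
    { Carrier = Series
    ; _≈_ = _≋_
    ; _∙_ = _⊛_
    ; ε = one
    ; isCommutativeMonoid = record
      { isMonoid = record
        { isSemigroup = record
          { isMagma = record { isEquivalence = ≋-isEquivalence ; ∙-cong = ⊛-cong }
          ; assoc = ⊛-assoc }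
        ; identity = ⊛-identityˡ , ⊛-identityʳ }
      ; comm = ⊛-comm }
    }

  open import Algebra.Properties.CommutativeSemigroup (CommutativeMonoid.commutativeSemigroup seriesMonoid)
    using () renaming (interchange to ⊛-interchange)
  open import Algebra.Properties.Monoid (CommutativeMonoid.monoid seriesMonoid) using () renaming (insertʳ to ⊛-insertʳ)
  open import Algebra.Solver.CommutativeMonoid seriesMonoid using (_⊕_; _⊜_) renaming (solve to ⊛-solve)

  ^ˢ-cong : ∀ {f g} m → f ≋ g → f ^ˢ m ≋ g ^ˢ m
  ^ˢ-cong zero    f≋g = ≋-refl
  ^ˢ-cong (suc m) f≋g = ⊛-cong f≋g (^ˢ-cong m f≋g)

  ^ˢ-+ : ∀ f m n → f ^ˢ (m ℕ.+ n) ≋ f ^ˢ m ⊛ f ^ˢ n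
  ^ˢ-+ f zero    n = ≋-sym (⊛-identityˡ (f ^ˢ n))
  ^ˢ-+ f (suc m) n = ≋-trans (⊛-congˡ f (^ˢ-+ f m n)) (≋-sym (⊛-assoc f (f ^ˢ m) (f ^ˢ n)))

  ^ˢ-* : ∀ f m n → f ^ˢ (m ℕ.* n) ≋ (f ^ˢ n) ^ˢ m
  ^ˢ-* f zero    n = ≋-refl
  ^ˢ-* f (suc m) n = ≋-trans (^ˢ-+ f n (m ℕ.* n)) (⊛-congˡ (f ^ˢ n) (^ˢ-* f m n))

  ^ˢ-distrib-⊛ : ∀ f g m → (f ⊛ g) ^ˢ m ≋ f ^ˢ m ⊛ g ^ˢ m
  ^ˢ-distrib-⊛ f g zero    = ≋-sym (⊛-identityˡ one)
  ^ˢ-distrib-⊛ f g (suc m) = ≋-trans (⊛-congˡ (f ⊛ g) (^ˢ-distrib-⊛ f g m)) (⊛-interchange f g (f ^ˢ m) (g ^ˢ m))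

  one-^ˢ : ∀ m → one ^ˢ m ≋ one
  one-^ˢ zero    = ≋-refl
  one-^ˢ (suc m) = ≋-trans (⊛-identityˡ (one ^ˢ m)) (one-^ˢ m)

  prodFin-cong : ∀ n {f g} → (∀ k → k < n → f k ≋ g k) → prodFin n f ≋ prodFin n g
  prodFin-cong zero    f≋g = ≋-refl
  prodFin-cong (suc n) f≋g = ⊛-cong (prodFin-cong n (λ k k<n → f≋g k (ℕP.m<n⇒m<1+n k<n))) (f≋g n ℕP.≤-refl)

  prodFin-⊛ : ∀ n f g → prodFin n (λ k → f k ⊛ g k) ≋ prodFin n f ⊛ prodFin n g
  prodFin-⊛ zero    f g = ≋-sym (⊛-identityˡ one)
  prodFin-⊛ (suc n) f g = ≋-trans (⊛-congʳ (f n ⊛ g n) (prodFin-⊛ n f g))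
                                 (⊛-interchange (prodFin n f) (prodFin n g) (f n) (g n))

  prodFin-const : ∀ n f → prodFin n (λ _ → f) ≋ f ^ˢ n
  prodFin-const zero    f = ≋-refl
  prodFin-const (suc n) f = ≋-trans (⊛-congʳ f (prodFin-const n f)) (⊛-comm (f ^ˢ n) f)

  prodFin-unconsˡ : ∀ n f → prodFin (suc n) f ≋ f 0 ⊛ prodFin n (λ k → f (suc k))
  prodFin-unconsˡ zero    f = ≋-trans (⊛-identityˡ (f 0)) (≋-sym (⊛-identityʳ (f 0)))
  prodFin-unconsˡ (suc n) f = ≋-trans (⊛-congʳ (f (suc n)) (prodFin-unconsˡ n f))
                                     (⊛-assoc (f 0) (prodFin n (λ k → f (suc k))) (f (suc n)))

  prodFin-rotate₁ : ∀ n f → f n ≋ f 0 → prodFin n (λ k → f (suc k)) ≋ prodFin n f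
  prodFin-rotate₁ zero    f fₙ≋f₀ = ≋-refl
  prodFin-rotate₁ (suc n) f fₙ≋f₀ = begin
    prodFin n (λ k → f (suc k)) ⊛ f (suc n)    ≈⟨ ⊛-congˡ (prodFin n (λ k → f (suc k))) fₙ≋f₀ ⟩
    prodFin n (λ k → f (suc k)) ⊛ f 0          ≈⟨ ⊛-comm _ _ ⟩
    f 0 ⊛ prodFin n (λ k → f (suc k))          ≈⟨ prodFin-unconsˡ n f ⟨
    prodFin (suc n) f                          ∎
    where open ≋-Reasoning

  prodFin-rotate : ∀ N f → (∀ k → f (k ℕ.+ N) ≋ f k) → ∀ h → prodFin N (λ k → f (k ℕ.+ h)) ≋ prodFin N f
  prodFin-rotate N f periodic zero    = prodFin-cong N (λ k _ → ≡⇒≋ (≡.cong f (ℕP.+-identityʳ k)))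
  prodFin-rotate N f periodic (suc h) = begin
    prodFin N (λ k → f (k ℕ.+ suc h))        ≈⟨ prodFin-cong N (λ k _ → ≡⇒≋ (≡.cong f (ℕP.+-suc k h))) ⟩
    prodFin N (λ k → f (suc k ℕ.+ h))        ≈⟨ prodFin-rotate₁ N (λ k → f (k ℕ.+ h)) fₙ₊ₕ≋fₕ ⟩
    prodFin N (λ k → f (k ℕ.+ h))            ≈⟨ prodFin-rotate N f periodic h ⟩
    prodFin N f                              ∎
    where
    open ≋-Reasoning
    fₙ₊ₕ≋fₕ : f (N ℕ.+ h) ≋ f h
    fₙ₊ₕ≋fₕ = ≋-trans (≡⇒≋ (≡.cong f (ℕP.+-comm N h))) (periodic h)

  prodTo-cong : ∀ {f g} → (∀ n → f (suc n) ≋ g (suc n)) → ∀ N → prodTo f N ≋ prodTo g N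
  prodTo-cong f≋g zero    = ≋-refl
  prodTo-cong f≋g (suc N) = ⊛-cong (prodTo-cong f≋g N) (f≋g N)

  prodTo-⊛ : ∀ f g N → prodTo (λ n → f n ⊛ g n) N ≋ prodTo f N ⊛ prodTo g N
  prodTo-⊛ f g zero    = ≋-sym (⊛-identityˡ one)
  prodTo-⊛ f g (suc N) = ≋-trans (⊛-congʳ (f (suc N) ⊛ g (suc N)) (prodTo-⊛ f g N))
                                 (⊛-interchange (prodTo f N) (prodTo g N) (f (suc N)) (g (suc N)))

  prodTo-one : ∀ N → prodTo (λ _ → one) N ≋ one
  prodTo-one zero    = ≋-refl
  prodTo-one (suc N) = ≋-trans (⊛-identityʳ (prodTo (λ _ → one) N)) (prodTo-one N)

  -- Infinite products

  infix 4 _≋[_]_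
  record _≋[_]_ (f : Series) (N : ℕ) (g : Series) : Set ℓ where
    constructor mk≋[]
    field coeff< : ∀ i → i < N → f i ≈ g i
  open _≋[_]_ public

  ≋[]-refl : ∀ {N f} → f ≋[ N ] f
  ≋[]-refl = mk≋[] (λ _ _ → refl)

  ≋⇒≋[] : ∀ {N f g} → f ≋ g → f ≋[ N ] g
  ≋⇒≋[] f≋g = mk≋[] (λ i _ → coeff f≋g i)

  ≋[]-trans : ∀ {N f g h} → f ≋[ N ] g → g ≋[ N ] h → f ≋[ N ] h
  ≋[]-trans f≋g g≋h = mk≋[] (λ i i<N → trans (coeff< f≋g i i<N) (coeff< g≋h i i<N))

  ≋[]-weaken : ∀ {K N f g} → K ≤ N → f ≋[ N ] g → f ≋[ K ] g
  ≋[]-weaken K≤N f≋g = mk≋[] (λ i i<K → coeff< f≋g i (ℕP.<-≤-trans i<K K≤N))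

  ⊛-cong-≋[] : ∀ {N a a′ b b′} → a ≋[ N ] a′ → b ≋[ N ] b′ → a ⊛ b ≋[ N ] a′ ⊛ b′
  ⊛-cong-≋[] a≋a′ b≋b′ = mk≋[] (λ i i<N → sumTo-cong (suc i) (λ j j≤i →
    *-cong (coeff< a≋a′ j (ℕP.≤-<-trans (ℕP.≤-pred j≤i) i<N)) (coeff< b≋b′ (i ∸ j) (ℕP.≤-<-trans (ℕP.m∸n≤m i j) i<N))))

  ⊛-≋[]-one : ∀ {N f g} → f ≋[ N ] one → g ≋[ N ] one → f ⊛ g ≋[ N ] one
  ⊛-≋[]-one f≋1 g≋1 = ≋[]-trans (⊛-cong-≋[] f≋1 g≋1) (≋⇒≋[] (⊛-identityʳ one))

  ^ˢ-≋[]-one : ∀ {N f} m → f ≋[ N ] one → f ^ˢ m ≋[ N ] one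
  ^ˢ-≋[]-one zero    f≋1 = ≋[]-refl
  ^ˢ-≋[]-one (suc m) f≋1 = ⊛-≋[]-one f≋1 (^ˢ-≋[]-one m f≋1)

  prodFin-≋[]-one : ∀ {N} n f → (∀ k → f k ≋[ N ] one) → prodFin n f ≋[ N ] one
  prodFin-≋[]-one zero    f f≋1 = ≋[]-refl
  prodFin-≋[]-one (suc n) f f≋1 = ⊛-≋[]-one (prodFin-≋[]-one n f f≋1) (f≋1 n)

  ⊛-≋[]-absorb : ∀ {N} g {h} → h ≋[ N ] one → g ⊛ h ≋[ N ] g
  ⊛-≋[]-absorb g h≋1 = ≋[]-trans (⊛-cong-≋[] ≋[]-refl h≋1) (≋⇒≋[] (⊛-identityʳ g))

  -- The families for which prodInf is the infinite product: the n-th factor is 1 modulo xⁿ.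
  Admissible : (ℕ → Series) → Set ℓ
  Admissible f = ∀ n → f n ≋[ n ] one

  admissible-^ˢ : ∀ {f} m → Admissible f → Admissible (λ n → f n ^ˢ m)
  admissible-^ˢ m f-adm n = ^ˢ-≋[]-one m (f-adm n)

  admissible-scaled : ∀ {f} r → 0 < r → Admissible f → Admissible (λ n → f (r ℕ.* n))
  admissible-scaled r 0<r f-adm n = ≋[]-weaken (ℕP.m≤n*m n r {{ℕ.>-nonZero 0<r}}) (f-adm (r ℕ.* n))

  prodTo-stable : ∀ {f} → Admissible f → ∀ N k → prodTo f (N ℕ.+ k) ≋[ suc N ] prodTo f N
  prodTo-stable {f} f-adm N zero    = ≋⇒≋[] (≡⇒≋ (≡.cong (prodTo f) (ℕP.+-identityʳ N)))
  prodTo-stable {f} f-adm N (suc k) rewrite ℕP.+-suc N k =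
    ≋[]-trans (⊛-≋[]-absorb (prodTo f (N ℕ.+ k)) (≋[]-weaken (s≤s (ℕP.m≤m+n N k)) (f-adm (suc (N ℕ.+ k)))))
              (prodTo-stable f-adm N k)

  prodInf-≋[]-prodTo : ∀ {f} → Admissible f → ∀ N → prodInf f ≋[ suc N ] prodTo f N
  prodInf-≋[]-prodTo {f} f-adm N = mk≋[] λ i i≤N →
    ≡.subst (λ t → prodTo f i i ≈ prodTo f t i) (ℕP.m+[n∸m]≡n (ℕP.≤-pred i≤N))
            (sym (coeff< (prodTo-stable f-adm i (N ∸ i)) i ℕP.≤-refl))

  prodInf-unique : ∀ {X f} → (∀ N → X ≋[ suc N ] prodTo f N) → X ≋ prodInf f
  prodInf-unique X≋ = mk≋ (λ N → coeff< (X≋ N) N ℕP.≤-refl)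

  prodInf-cong : ∀ {f g} → (∀ n → f (suc n) ≋ g (suc n)) → prodInf f ≋ prodInf g
  prodInf-cong f≋g = mk≋ (λ N → coeff (prodTo-cong f≋g N) N)

  prodInf-⊛ : ∀ {f g} → Admissible f → Admissible g → prodInf f ⊛ prodInf g ≋ prodInf (λ n → f n ⊛ g n)
  prodInf-⊛ {f} {g} f-adm g-adm = prodInf-unique λ N →
    ≋[]-trans (⊛-cong-≋[] (prodInf-≋[]-prodTo f-adm N) (prodInf-≋[]-prodTo g-adm N)) (≋⇒≋[] (≋-sym (prodTo-⊛ f g N)))

  prodInf-one : prodInf (λ _ → one) ≋ one
  prodInf-one = ≋-sym (prodInf-unique (λ N → ≋⇒≋[] (≋-sym (prodTo-one N))))

  prodInf-^ˢ : ∀ {f} → Admissible f → ∀ m → prodInf f ^ˢ m ≋ prodInf (λ n → f n ^ˢ m)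
  prodInf-^ˢ f-adm zero        = ≋-sym prodInf-one
  prodInf-^ˢ {f} f-adm (suc m) =
    ≋-trans (⊛-congˡ (prodInf f) (prodInf-^ˢ f-adm m)) (prodInf-⊛ f-adm (admissible-^ˢ m f-adm))

  prodFin-prodInf : ∀ n (h : ℕ → ℕ → Series) → (∀ k → Admissible (h k)) →
    prodFin n (λ k → prodInf (h k)) ≋ prodInf (λ j → prodFin n (λ k → h k j))
  prodFin-prodInf zero    h h-adm = ≋-sym prodInf-one
  prodFin-prodInf (suc n) h h-adm =
    ≋-trans (⊛-congʳ (prodInf (h n)) (prodFin-prodInf n h h-adm))
            (prodInf-⊛ (λ j → prodFin-≋[]-one n (λ k → h k j) (λ k → h-adm k j)) (h-adm n))

  prodTo-skip : ∀ f M k → (∀ i → i < k → f (suc (M ℕ.+ i)) ≋ one) → prodTo f (M ℕ.+ k) ≋ prodTo f M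
  prodTo-skip f M zero    _       = ≡⇒≋ (≡.cong (prodTo f) (ℕP.+-identityʳ M))
  prodTo-skip f M (suc k) trivial rewrite ℕP.+-suc M k =
    ≋-trans (⊛-congˡ (prodTo f (M ℕ.+ k)) (trivial k ℕP.≤-refl))
            (≋-trans (⊛-identityʳ (prodTo f (M ℕ.+ k))) (prodTo-skip f M k (λ i i<k → trivial i (ℕP.m<n⇒m<1+n i<k))))

  prodInf-multiples : ∀ r′ f → (∀ n → ¬ suc r′ ∣ n → f n ≋ one) → Admissible f →
    prodInf f ≋ prodInf (λ m → f (suc r′ ℕ.* m))
  prodInf-multiples r′ f trivial f-adm = prodInf-unique λ N →
    ≋[]-trans (≋[]-weaken (s≤s (ℕP.m≤n*m N r)) (prodInf-≋[]-prodTo f-adm (r ℕ.* N))) (≋⇒≋[] (blocks N))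
    where
    r = suc r′
    r∤ : ∀ N i → i < r′ → ¬ r ∣ suc (r ℕ.* N ℕ.+ i)
    r∤ N i i<r′ r∣ = ℕP.<⇒≱ (s≤s i<r′) (∣⇒≤ (∣m+n∣m⇒∣n (≡.subst (r ∣_) (≡.sym (ℕP.+-suc (r ℕ.* N) i)) r∣) (m∣m*n N)))
    r*[1+N] : ∀ N → r ℕ.* suc N ≡ suc (r ℕ.* N ℕ.+ r′)
    r*[1+N] N = ≡.trans (ℕP.*-suc r N) (≡.cong suc (ℕP.+-comm r′ (r ℕ.* N)))
    g : ℕ → Series
    g m = f (r ℕ.* m)
    blocks : ∀ N → prodTo f (r ℕ.* N) ≋ prodTo g N
    blocks zero    = ≡⇒≋ (≡.cong (prodTo f) (ℕP.*-zeroʳ r))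
    blocks (suc N) = begin
      prodTo f (r ℕ.* suc N)                                 ≡⟨ ≡.cong (prodTo f) (r*[1+N] N) ⟩
      prodTo f (r ℕ.* N ℕ.+ r′) ⊛ f (suc (r ℕ.* N ℕ.+ r′))   ≈⟨ ⊛-congʳ (f (suc (r ℕ.* N ℕ.+ r′))) (≋-trans
        (prodTo-skip f (r ℕ.* N) r′ (λ i i<r′ → trivial _ (r∤ N i i<r′))) (blocks N)) ⟩
      prodTo g N ⊛ f (suc (r ℕ.* N ℕ.+ r′))                  ≡⟨ ≡.cong (λ t → prodTo g N ⊛ f t) (r*[1+N] N) ⟨
      prodTo g (suc N)                                       ∎
      where open ≋-Reasoning

  dropIf keepIf : ∀ {P : Set} → Dec P → Series → Series
  dropIf (yes _) f = one
  dropIf (no  _) f = f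
  keepIf (yes _) f = f
  keepIf (no  _) f = one

  dropIf-⊛-keepIf : ∀ {P : Set} (d : Dec P) f → f ≋ dropIf d f ⊛ keepIf d f
  dropIf-⊛-keepIf (yes _) f = ≋-sym (⊛-identityˡ f)
  dropIf-⊛-keepIf (no  _) f = ≋-sym (⊛-identityʳ f)

  dropIf-≋[]-one : ∀ {P : Set} (d : Dec P) {N f} → f ≋[ N ] one → dropIf d f ≋[ N ] one
  dropIf-≋[]-one (yes _) f≋1 = ≋[]-refl
  dropIf-≋[]-one (no  _) f≋1 = f≋1

  keepIf-≋[]-one : ∀ {P : Set} (d : Dec P) {N f} → f ≋[ N ] one → keepIf d f ≋[ N ] one
  keepIf-≋[]-one (yes _) f≋1 = f≋1
  keepIf-≋[]-one (no  _) f≋1 = ≋[]-refl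

  keepIf-yes : ∀ {P : Set} (d : Dec P) f → P → keepIf d f ≋ f
  keepIf-yes (yes _) f p = ≋-refl
  keepIf-yes (no ¬p) f p = contradiction p ¬p

  keepIf-no : ∀ {P : Set} (d : Dec P) f → ¬ P → keepIf d f ≋ one
  keepIf-no (yes p) f ¬p = contradiction p ¬p
  keepIf-no (no  _) f ¬p = ≋-refl

  offMultiples : ℕ → (ℕ → Series) → ℕ → Series
  offMultiples r f n = dropIf (r ∣? n) (f n)

  prodInf-split : ∀ {r f} → 0 < r → Admissible f →
    prodInf f ≋ prodInf (offMultiples r f) ⊛ prodInf (λ m → f (r ℕ.* m))
  prodInf-split {suc r′} {f} _ f-adm = begin
    prodInf f
      ≈⟨ prodInf-cong (λ n → dropIf-⊛-keepIf (r ∣? suc n) (f (suc n))) ⟩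
    prodInf (λ n → off n ⊛ on n)
      ≈⟨ prodInf-⊛ off-adm on-adm ⟨
    prodInf off ⊛ prodInf on
      ≈⟨ ⊛-congˡ (prodInf off) (prodInf-multiples r′ on on-trivial on-adm) ⟩
    prodInf off ⊛ prodInf (λ m → on (r ℕ.* m))
      ≈⟨ ⊛-congˡ (prodInf off) (prodInf-cong on-multiple) ⟩
    prodInf off ⊛ prodInf (λ m → f (r ℕ.* m))
      ∎
    where
    open ≋-Reasoning
    r = suc r′
    off on : ℕ → Series
    off = offMultiples r f
    on n = keepIf (r ∣? n) (f n)
    off-adm : Admissible off
    off-adm n = dropIf-≋[]-one (r ∣? n) (f-adm n)
    on-adm : Admissible on
    on-adm n = keepIf-≋[]-one (r ∣? n) (f-adm n)
    on-trivial : ∀ n → ¬ r ∣ n → on n ≋ one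
    on-trivial n = keepIf-no (r ∣? n) (f n)
    on-multiple : ∀ m → on (r ℕ.* suc m) ≋ f (r ℕ.* suc m)
    on-multiple m = keepIf-yes (r ∣? r ℕ.* suc m) (f (r ℕ.* suc m)) (m∣m*n (suc m))

  -- Binomials 1 + a xⁿ.  By definition, onePlus y n = binomial (pow y n) n and
  -- oneMinus y n = binomial (- pow y n) n.

  binomial : Carrier → ℕ → Series
  binomial a n i = if does (i ℕ.≟ 0) then 1# else (if does (i ℕ.≟ n) then a else 0#)

  monomial : Carrier → ℕ → Series
  monomial a n i = if does (i ℕ.≟ n) then a else 0#

  monomial-≢ : ∀ a {n i} → i ≢ n → monomial a n i ≈ 0#
  monomial-≢ a {n} {i} i≢n rewrite dec-false (i ℕ.≟ n) i≢n = refl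

  monomial-≡ : ∀ a n → monomial a n n ≈ a
  monomial-≡ a n rewrite dec-true (n ℕ.≟ n) ≡.refl = refl

  binomial-≡ : ∀ a {n} → 0 < n → binomial a n n ≈ a
  binomial-≡ a {suc n} _ = monomial-≡ a (suc n)

  binomial-≢ : ∀ a {n i} → i ≢ 0 → i ≢ n → binomial a n i ≈ 0#
  binomial-≢ a {n} {suc i} _ i≢n = monomial-≢ a i≢n
  binomial-≢ a {n} {zero}  i≢0 _ = contradiction ≡.refl i≢0

  binomial-cong : ∀ {a b} n → a ≈ b → binomial a n ≋ binomial b n
  binomial-cong {a} {b} n a≈b = mk≋ coeffs
    where
    coeffs : ∀ i → binomial a n i ≈ binomial b n i
    coeffs zero    = refl
    coeffs (suc i) with does (suc i ℕ.≟ n)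
    ... | true  = a≈b
    ... | false = refl

  binomial≈one+monomial : ∀ a {n} → 0 < n → ∀ i → binomial a n i ≈ one i + monomial a n i
  binomial≈one+monomial a {suc n} _ zero    = sym (+-identityʳ 1#)
  binomial≈one+monomial a {suc n} _ (suc i) = sym (+-identityˡ _)

  binomial-≋[]-one : ∀ a n → binomial a n ≋[ n ] one
  binomial-≋[]-one a n = mk≋[] λ where
    zero    _     → refl
    (suc i) i+1<n → binomial-≢ a (λ ()) (ℕP.<⇒≢ i+1<n)

  ⊛-monomial-< : ∀ g a {n N} → N < n → (g ⊛ monomial a n) N ≈ 0#
  ⊛-monomial-< g a {n} {N} N<n = sumTo-zero (suc N) (λ i _ →
    trans (*-congˡ (monomial-≢ a (ℕP.<⇒≢ (ℕP.≤-<-trans (ℕP.m∸n≤m N i) N<n)))) (zeroʳ _))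

  ⊛-monomial-+ : ∀ g a n k → (g ⊛ monomial a n) (n ℕ.+ k) ≈ g k * a
  ⊛-monomial-+ g a n k = begin
    sumTo (suc (n ℕ.+ k)) (λ i → g i * monomial a n (n ℕ.+ k ∸ i))
      ≈⟨ sumTo-single (suc (n ℕ.+ k)) k _ (s≤s (ℕP.m≤n+m k n)) others ⟩
    g k * monomial a n (n ℕ.+ k ∸ k)   ≡⟨ ≡.cong (λ t → g k * monomial a n t) (ℕP.m+n∸n≡m n k) ⟩
    g k * monomial a n n               ≈⟨ *-congˡ (monomial-≡ a n) ⟩
    g k * a                            ∎
    where
    open ≈-Reasoning
    others : ∀ i → i < suc (n ℕ.+ k) → i ≢ k → g i * monomial a n (n ℕ.+ k ∸ i) ≈ 0#
    others i i≤n+k i≢k = trans (*-congˡ (monomial-≢ a (λ n+k∸i≡n → i≢k (ℕP.+-cancelˡ-≡ n i k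
      (≡.trans (≡.cong (ℕ._+ i) (≡.sym n+k∸i≡n)) (ℕP.m∸n+n≡m (ℕP.≤-pred i≤n+k))))))) (zeroʳ _)

  ⊛-binomial : ∀ g a {n} → 0 < n → ∀ N → (g ⊛ binomial a n) N ≈ g N + (g ⊛ monomial a n) N
  ⊛-binomial g a {n} 0<n N = begin
    sumTo (suc N) (λ i → g i * binomial a n (N ∸ i))
      ≈⟨ sumTo-cong′ (suc N) (λ i → trans (*-congˡ (binomial≈one+monomial a 0<n (N ∸ i))) (distribˡ _ _ _)) ⟩
    sumTo (suc N) (λ i → g i * one (N ∸ i) + g i * monomial a n (N ∸ i))
      ≈⟨ sumTo-+ (suc N) _ _ ⟩
    (g ⊛ one) N + (g ⊛ monomial a n) N
      ≈⟨ +-congʳ (coeff (⊛-identityʳ g) N) ⟩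
    g N + (g ⊛ monomial a n) N
      ∎
    where open ≈-Reasoning

  ⊛-binomial-< : ∀ g a {n N} → 0 < n → N < n → (g ⊛ binomial a n) N ≈ g N
  ⊛-binomial-< g a {n} {N} 0<n N<n =
    trans (⊛-binomial g a 0<n N) (trans (+-congˡ (⊛-monomial-< g a N<n)) (+-identityʳ (g N)))

  ⊛-binomial-+ : ∀ g a {n} → 0 < n → ∀ k → (g ⊛ binomial a n) (n ℕ.+ k) ≈ g (n ℕ.+ k) + g k * a
  ⊛-binomial-+ g a {n} 0<n k = trans (⊛-binomial g a 0<n (n ℕ.+ k)) (+-congˡ (⊛-monomial-+ g a n k))

  invOneMinus-∣ : ∀ y n {m} → n ∣ m → invOneMinus y n m ≈ pow y m
  invOneMinus-∣ y n {m} n∣m rewrite dec-true (n ∣? m) n∣m = refl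

  invOneMinus-∤ : ∀ y n {m} → ¬ n ∣ m → invOneMinus y n m ≈ 0#
  invOneMinus-∤ y n {m} n∤m rewrite dec-false (n ∣? m) n∤m = refl

  invOneMinus-≋[]-one : ∀ y n → invOneMinus y n ≋[ n ] one
  invOneMinus-≋[]-one y n = mk≋[] λ where
    zero    _     → invOneMinus-∣ y n (n ∣0)
    (suc i) i+1<n → invOneMinus-∤ y n (λ n∣i+1 → ℕP.<⇒≱ i+1<n (∣⇒≤ n∣i+1))

  oneMinus-invOneMinus : ∀ y {n} → 0 < n → oneMinus y n ⊛ invOneMinus y n ≋ one
  oneMinus-invOneMinus y {n} 0<n = ≋-trans (⊛-comm (oneMinus y n) I) (mk≋ coeffs)
    where
    I = invOneMinus y n
    coeffs : ∀ N → (I ⊛ binomial (- pow y n) n) N ≈ one N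
    coeffs N with ℕP.<-≤-connex N n
    ... | inj₁ N<n = trans (⊛-binomial-< I _ 0<n N<n) (coeff< (invOneMinus-≋[]-one y n) N N<n)
    ... | inj₂ n≤N rewrite ≡.sym (ℕP.m+[n∸m]≡n n≤N) =
      trans (⊛-binomial-+ I _ 0<n k) (trans (coeff-n+k (n ∣? k)) (sym (one-pos (ℕP.<-≤-trans 0<n (ℕP.m≤m+n n k)))))
      where
      k = N ∸ n
      coeff-n+k : Dec (n ∣ k) → I (n ℕ.+ k) + I k * - pow y n ≈ 0#
      coeff-n+k (yes n∣k) = begin
        I (n ℕ.+ k) + I k * - pow y n
          ≈⟨ +-cong (invOneMinus-∣ y n (∣m∣n⇒∣m+n ∣-refl n∣k)) (*-congʳ (invOneMinus-∣ y n n∣k)) ⟩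
        pow y (n ℕ.+ k) + pow y k * - pow y n
          ≈⟨ +-cong (trans (pow-+ y n k) (*-comm _ _)) (sym (-‿distribʳ-* _ _)) ⟩
        pow y k * pow y n - pow y k * pow y n
          ≈⟨ -‿inverseʳ _ ⟩
        0#
          ∎
        where open ≈-Reasoning
      coeff-n+k (no n∤k) = begin
        I (n ℕ.+ k) + I k * - pow y n
          ≈⟨ +-cong (invOneMinus-∤ y n (λ n∣n+k → n∤k (∣m+n∣m⇒∣n n∣n+k ∣-refl))) (*-congʳ (invOneMinus-∤ y n n∤k)) ⟩
        0# + 0# * - pow y n
          ≈⟨ trans (+-identityˡ _) (zeroˡ _) ⟩
        0#
          ∎
        where open ≈-Reasoning

  ⊛-inverse-unique : ∀ a b d → a ⊛ b ≋ one → a ⊛ d ≋ one → b ≋ d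
  ⊛-inverse-unique a b d ab≋1 ad≋1 = begin
    b               ≈⟨ ⊛-identityʳ b ⟨
    b ⊛ one         ≈⟨ ⊛-congˡ b ad≋1 ⟨
    b ⊛ (a ⊛ d)     ≈⟨ ⊛-assoc b a d ⟨
    (b ⊛ a) ⊛ d     ≈⟨ ⊛-congʳ d (≋-trans (⊛-comm b a) ab≋1) ⟩
    one ⊛ d         ≈⟨ ⊛-identityˡ d ⟩
    d               ∎
    where open ≋-Reasoning

  -- Cyclotomic products

  tri : ℕ → ℕ
  tri zero    = 0
  tri (suc m) = tri m ℕ.+ m

  tri-odd : ∀ h → tri (suc (2 ℕ.* h)) ≡ suc (2 ℕ.* h) ℕ.* h
  tri-odd zero    = ≡.refl
  tri-odd (suc h) = begin
    tri (suc (2 ℕ.* suc h))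
      ≡⟨ ≡.cong (tri ∘ suc) (ℕP.*-suc 2 h) ⟩
    tri (suc (2 ℕ.* h)) ℕ.+ suc (2 ℕ.* h) ℕ.+ suc (suc (2 ℕ.* h))
      ≡⟨ ≡.cong (λ t → t ℕ.+ suc (2 ℕ.* h) ℕ.+ suc (suc (2 ℕ.* h))) (tri-odd h) ⟩
    suc (2 ℕ.* h) ℕ.* h ℕ.+ suc (2 ℕ.* h) ℕ.+ suc (suc (2 ℕ.* h))
      ≡⟨ odd-step h ⟩
    suc (suc (suc (2 ℕ.* h))) ℕ.* suc h
      ≡⟨ ≡.cong (λ t → suc t ℕ.* suc h) (ℕP.*-suc 2 h) ⟨
    suc (2 ℕ.* suc h) ℕ.* suc h
      ∎
    where
    open ≡.≡-Reasoning
    odd-step : ∀ h → suc (2 ℕ.* h) ℕ.* h ℕ.+ suc (2 ℕ.* h) ℕ.+ suc (suc (2 ℕ.* h)) ≡ suc (suc (suc (2 ℕ.* h))) ℕ.* suc h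
    odd-step = solve-∀

  pow-tri-odd : ∀ {ζ r h} → r ≡ suc (2 ℕ.* h) → pow ζ r ≈ 1# → pow ζ (tri r) ≈ 1#
  pow-tri-odd {ζ} {h = h} ≡.refl ζʳ≈1 =
    ≡.subst (λ t → pow ζ t ≈ 1#) (≡.sym (tri-odd h)) (pow-root-of-unity {ζ} {suc (2 ℕ.* h)} ζʳ≈1 h)

  -- esym m i is the i-th elementary symmetric function of a, a ζ, …, a ζ^(m−1), i.e. the coefficient of
  -- x^(i n) in Π_{k<m} (1 + a ζ^k xⁿ).
  module ElementarySymmetric (ζ a : Carrier) where

    esym : ℕ → ℕ → Carrier
    esym zero    zero    = 1#
    esym zero    (suc i) = 0#
    esym (suc m) zero    = 1#
    esym (suc m) (suc i) = esym m (suc i) + a * pow ζ m * esym m i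

    esym-zero : ∀ m → esym m 0 ≈ 1#
    esym-zero zero    = refl
    esym-zero (suc m) = refl

    esym-> : ∀ m i → m < i → esym m i ≈ 0#
    esym-> zero    (suc i) _         = refl
    esym-> (suc m) (suc i) (s≤s m<i) =
      trans (+-cong (esym-> m (suc i) (ℕP.m<n⇒m<1+n m<i)) (trans (*-congˡ (esym-> m i m<i)) (zeroʳ _))) (+-identityʳ 0#)

    esym-diagonal : ∀ m → esym m m ≈ pow a m * pow ζ (tri m)
    esym-diagonal zero    = sym (*-identityʳ 1#)
    esym-diagonal (suc m) = begin
      esym m (suc m) + a * pow ζ m * esym m m
        ≈⟨ +-cong (esym-> m (suc m) ℕP.≤-refl) (*-congˡ (esym-diagonal m)) ⟩
      0# + a * pow ζ m * (pow a m * pow ζ (tri m))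
        ≈⟨ solve 4 (λ a zm am zt → con 0 :+ a :* zm :* (am :* zt) := a :* am :* (zt :* zm))
                                                          refl a (pow ζ m) (pow a m) (pow ζ (tri m)) ⟩
      a * pow a m * (pow ζ (tri m) * pow ζ m)
        ≈⟨ *-congˡ (pow-+ ζ (tri m) m) ⟨
      pow a (suc m) * pow ζ (tri (suc m))
        ∎
      where open ≈-Reasoning

    esym-one : ∀ m → esym m 1 ≈ a * geom ζ m
    esym-one zero    = sym (zeroʳ a)
    esym-one (suc m) = begin
      esym m 1 + a * pow ζ m * esym m 0     ≈⟨ +-cong (esym-one m) (trans (*-congˡ (esym-zero m)) (*-identityʳ _)) ⟩
      a * geom ζ m + a * pow ζ m            ≈⟨ distribˡ a _ _ ⟨
      a * geom ζ (suc m)                    ∎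
      where open ≈-Reasoning

    pascal-step : ∀ {M} i u → suc i ℕ.+ u ≡ M →
      geom ζ (suc (suc i)) * esym M (suc (suc i)) ≈ a * pow ζ (suc i) * geom ζ (M ∸ suc i) * esym M (suc i) →
      geom ζ (suc i) * esym M (suc i) ≈ a * pow ζ i * geom ζ (M ∸ i) * esym M i →
      geom ζ (suc (suc i)) * esym (suc M) (suc (suc i)) ≈ a * pow ζ (suc i) * geom ζ (M ∸ i) * esym (suc M) (suc i)
    pascal-step i u ≡.refl h₁′ h₂′ = begin
      G₂ * (A + x * B)
        ≈⟨ distribˡ G₂ A (x * B) ⟩
      G₂ * A + G₂ * (x * B)
        ≈⟨ +-cong h₁ (*-cong (geom-suc ζ (suc i)) (*-congʳ (*-congˡ ζᴹ))) ⟩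
      a * (ζ * Z) * Gᵤ * B + (1# + ζ * G₁) * (a * (ζ * (Z * U)) * B)
        ≈⟨ solve 7 (λ a ζ Z U Gᵤ G₁ B → a :* (ζ :* Z) :* Gᵤ :* B :+ (con 1 :+ ζ :* G₁) :* (a :* (ζ :* (Z :* U)) :* B)
                   := a :* (ζ :* Z) :* Gᵤ :* B :+ a :* (ζ :* (Z :* U)) :* B :+ ζ :* (a :* (ζ :* (Z :* U))) :* (G₁ :* B))
                   refl a ζ Z U Gᵤ G₁ B ⟩
      a * (ζ * Z) * Gᵤ * B + a * (ζ * (Z * U)) * B + ζ * (a * (ζ * (Z * U))) * (G₁ * B)
        ≈⟨ +-congˡ (*-congˡ h₂) ⟩
      a * (ζ * Z) * Gᵤ * B + a * (ζ * (Z * U)) * B + ζ * (a * (ζ * (Z * U))) * (a * Z * (Gᵤ + U) * C)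
        ≈⟨ solve 7 (λ a ζ Z U Gᵤ B C → a :* (ζ :* Z) :* Gᵤ :* B :+ a :* (ζ :* (Z :* U)) :* B
                                     :+ ζ :* (a :* (ζ :* (Z :* U))) :* (a :* Z :* (Gᵤ :+ U) :* C)
                   := a :* (ζ :* Z) :* (Gᵤ :+ U) :* (B :+ a :* (ζ :* (Z :* U)) :* C))
                   refl a ζ Z U Gᵤ B C ⟩
      a * (ζ * Z) * (Gᵤ + U) * (B + a * (ζ * (Z * U)) * C)
        ≈⟨ *-cong (*-congˡ [M-i]) (+-congˡ (*-congʳ (*-congˡ ζᴹ))) ⟨
      a * (ζ * Z) * geom ζ (M ∸ i) * (B + x * C)
        ∎
      where
      open ≈-Reasoning
      M = suc i ℕ.+ u
      A = esym M (suc (suc i))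
      B = esym M (suc i)
      C = esym M i
      x = a * pow ζ M
      Z = pow ζ i
      U = pow ζ u
      Gᵤ = geom ζ u
      G₁ = geom ζ (suc i)
      G₂ = geom ζ (suc (suc i))
      ζᴹ : pow ζ M ≈ ζ * (Z * U)
      ζᴹ = *-congˡ (pow-+ ζ i u)
      [M-i] : geom ζ (M ∸ i) ≈ Gᵤ + U
      [M-i] = reflexive (≡.cong (geom ζ) (≡.trans (ℕP.+-∸-assoc 1 (ℕP.m≤m+n i u)) (≡.cong suc (ℕP.m+n∸m≡n i u))))
      h₁ : G₂ * A ≈ a * (ζ * Z) * Gᵤ * B
      h₁ = trans h₁′ (*-congʳ (*-congˡ (reflexive (≡.cong (geom ζ) (ℕP.m+n∸m≡n i u)))))
      h₂ : G₁ * B ≈ a * Z * (Gᵤ + U) * C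
      h₂ = trans h₂′ (*-congʳ (*-congˡ [M-i]))

    -- The q-analogue of (i+1) C(m, i+1) = (m−i) C(m, i).
    geom-esym : ∀ m i → geom ζ (suc i) * esym m (suc i) ≈ a * pow ζ i * geom ζ (m ∸ i) * esym m i
    geom-esym m       zero    = begin
      (0# + 1#) * esym m 1
        ≈⟨ *-cong (+-identityˡ 1#) (esym-one m) ⟩
      1# * (a * geom ζ m)
        ≈⟨ solve 2 (λ a g → con 1 :* (a :* g) := a :* con 1 :* g :* con 1) refl a (geom ζ m) ⟩
      a * 1# * geom ζ m * 1#
        ≈⟨ *-congˡ (esym-zero m) ⟨
      a * 1# * geom ζ m * esym m 0
        ∎
      where open ≈-Reasoning
    geom-esym zero    (suc i) = trans (zeroʳ _) (sym (trans (*-congʳ (zeroʳ _)) (zeroˡ _)))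
    geom-esym (suc m) (suc i) with ℕP.<-≤-connex m (suc i)
    ... | inj₁ m<1+i = trans (*-congˡ (esym-> (suc m) (suc (suc i)) (s≤s m<1+i))) (trans (zeroʳ _)
                         (sym (trans (*-congʳ (trans (*-congˡ [m-i]≈0) (zeroʳ _))) (zeroˡ _))))
      where
      [m-i]≈0 : geom ζ (m ∸ i) ≈ 0#
      [m-i]≈0 = reflexive (≡.cong (geom ζ) (ℕP.m≤n⇒m∸n≡0 (ℕP.≤-pred m<1+i)))
    ... | inj₂ i<m   = pascal-step i (m ∸ suc i) (ℕP.m+[n∸m]≡n i<m) (geom-esym m (suc i)) (geom-esym m i)

    esym-prime : ∀ {r} → Prime r → geom ζ r ≈ 0# → ∀ i → suc i < r → esym r (suc i) ≈ 0#
    esym-prime {r} pr [r]≈0 i i+1<r =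
      invertible-cancel (geom-invertible pr [r]≈0 r∤i+1) (trans (geom-esym r i) (rhs≈0 i i+1<r))
      where
      r∤i+1 : ¬ r ∣ suc i
      r∤i+1 r∣i+1 = ℕP.<⇒≱ i+1<r (∣⇒≤ r∣i+1)
      rhs≈0 : ∀ i → suc i < r → a * pow ζ i * geom ζ (r ∸ i) * esym r i ≈ 0#
      rhs≈0 zero    _     = trans (*-congʳ (trans (*-congˡ [r]≈0) (zeroʳ _))) (zeroˡ _)
      rhs≈0 (suc i) i+2<r = trans (*-congˡ (esym-prime pr [r]≈0 i (ℕP.<-trans (ℕP.n<1+n _) i+2<r))) (zeroʳ _)

  module BinomialProduct (ζ a : Carrier) {n : ℕ} (0<n : 0 < n) where
    open ElementarySymmetric ζ a

    product : ℕ → Series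
    product m = prodFin m (λ k → binomial (a * pow ζ k) n)

    product-coeff-multiple : ∀ m i → product m (i ℕ.* n) ≈ esym m i
    product-coeff-multiple zero    zero    = refl
    product-coeff-multiple zero    (suc i) = one-pos (ℕP.<-≤-trans 0<n (ℕP.m≤m+n n _))
    product-coeff-multiple (suc m) zero    =
      trans (⊛-binomial-< (product m) (a * pow ζ m) 0<n 0<n) (trans (product-coeff-multiple m 0) (esym-zero m))
    product-coeff-multiple (suc m) (suc i) = begin
      (product m ⊛ binomial (a * pow ζ m) n) (n ℕ.+ i ℕ.* n)
        ≈⟨ ⊛-binomial-+ (product m) (a * pow ζ m) 0<n (i ℕ.* n) ⟩
      product m (n ℕ.+ i ℕ.* n) + product m (i ℕ.* n) * (a * pow ζ m)
        ≈⟨ +-cong (product-coeff-multiple m (suc i)) (*-congʳ (product-coeff-multiple m i)) ⟩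
      esym m (suc i) + esym m i * (a * pow ζ m)
        ≈⟨ +-congˡ (*-comm _ _) ⟩
      esym (suc m) (suc i)
        ∎
      where open ≈-Reasoning

    product-coeff-other : ∀ m {j} → ¬ n ∣ j → product m j ≈ 0#
    product-coeff-other zero    {zero}  n∤j = contradiction (n ∣0) n∤j
    product-coeff-other zero    {suc j} n∤j = refl
    product-coeff-other (suc m) {j}     n∤j with ℕP.<-≤-connex j n
    ... | inj₁ j<n = trans (⊛-binomial-< (product m) (a * pow ζ m) 0<n j<n) (product-coeff-other m n∤j)
    ... | inj₂ n≤j rewrite ≡.sym (ℕP.m+[n∸m]≡n n≤j) =
      trans (⊛-binomial-+ (product m) (a * pow ζ m) 0<n (j ∸ n))
            (trans (+-cong (product-coeff-other m n∤j) (*-congʳ (product-coeff-other m (n∤j ∘ ∣m∣n⇒∣m+n ∣-refl))))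
                   (trans (+-identityˡ _) (zeroˡ _)))

  -- esym r i vanishes for 0 < i < r: each [i]_ζ is invertible, so geom-esym carries [r]_ζ ≈ 0 upwards.
  prodFin-binomial-root : ∀ {ζ r} a {n} → 0 < n → Prime r → geom ζ r ≈ 0# →
    prodFin r (λ k → binomial (a * pow ζ k) n) ≋ binomial (pow a r * pow ζ (tri r)) (r ℕ.* n)
  prodFin-binomial-root {ζ} {r} a {n} 0<n pr [r]≈0 = mk≋ coeffs
    where
    open ElementarySymmetric ζ a
    open BinomialProduct ζ a 0<n
    0<r : 0 < r
    0<r = prime⇒pos pr
    0<rn : 0 < r ℕ.* n
    0<rn = ℕP.*-mono-< 0<r 0<n
    top = pow a r * pow ζ (tri r)
    q+1*n≢0 : ∀ q → suc q ℕ.* n ≢ 0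
    q+1*n≢0 q = ℕP.>⇒≢ (ℕP.<-≤-trans 0<n (ℕP.m≤m+n n (q ℕ.* n)))
    off-diagonal : ∀ {q} → suc q ≢ r → binomial top (r ℕ.* n) (suc q ℕ.* n) ≈ 0#
    off-diagonal {q} q+1≢r = binomial-≢ top (q+1*n≢0 q) (q+1≢r ∘ ℕP.*-cancelʳ-≡ _ r n {{ℕ.>-nonZero 0<n}})
    multiple : ∀ q → esym r q ≈ binomial top (r ℕ.* n) (q ℕ.* n)
    multiple zero = esym-zero r
    multiple (suc q) with ℕP.<-cmp (suc q) r
    ... | tri< q<r _ _   = trans (esym-prime pr [r]≈0 q q<r) (sym (off-diagonal (ℕP.<⇒≢ q<r)))
    ... | tri> _ _ q>r   = trans (esym-> r (suc q) q>r) (sym (off-diagonal (ℕP.>⇒≢ q>r)))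
    ... | tri≈ _ q+1≡r _ = begin
      esym r (suc q)                          ≡⟨ ≡.cong (esym r) q+1≡r ⟩
      esym r r                                ≈⟨ esym-diagonal r ⟩
      top                                     ≈⟨ binomial-≡ top 0<rn ⟨
      binomial top (r ℕ.* n) (r ℕ.* n)          ≡⟨ ≡.cong (λ t → binomial top (r ℕ.* n) (t ℕ.* n)) q+1≡r ⟨
      binomial top (r ℕ.* n) (suc q ℕ.* n)      ∎
      where open ≈-Reasoning
    coeffs : ∀ j → product r j ≈ binomial top (r ℕ.* n) j
    coeffs j with n ∣? j
    ... | yes (divides q ≡.refl) = trans (product-coeff-multiple r q) (multiple q)
    ... | no  n∤j                = trans (product-coeff-other r n∤j) (sym (binomial-≢ top
      (λ j≡0 → n∤j (≡.subst (n ∣_) (≡.sym j≡0) (n ∣0))) (λ j≡rn → n∤j (≡.subst (n ∣_) (≡.sym j≡rn) (n∣m*n r)))))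

  -- (1 + a xⁿ)(1 − a xⁿ) is the case r = 2, ζ = −1.
  binomial-⊛-neg : ∀ a {n} → 0 < n → binomial a n ⊛ binomial (- a) n ≋ binomial (- (a * a)) (2 ℕ.* n)
  binomial-⊛-neg a {n} 0<n = begin
    binomial a n ⊛ binomial (- a) n
      ≈⟨ ⊛-cong (≋-trans (⊛-identityˡ (binomial (a * 1#) n)) (binomial-cong n (*-identityʳ a)))
                (binomial-cong n (trans (*-congˡ (*-identityʳ (- 1#))) (trans (*-comm a (- 1#)) (-1*x≈-x a)))) ⟨
    prodFin 2 (λ k → binomial (a * pow (- 1#) k) n)
      ≈⟨ prodFin-binomial-root a 0<n prime[2] [2]₋₁≈0 ⟩
    binomial (pow a 2 * pow (- 1#) 1) (2 ℕ.* n)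
      ≈⟨ binomial-cong (2 ℕ.* n) a²·-1≈-a² ⟩
    binomial (- (a * a)) (2 ℕ.* n)
      ∎
    where
    open ≋-Reasoning
    [2]₋₁≈0 : geom (- 1#) 2 ≈ 0#
    [2]₋₁≈0 = trans (+-cong (+-identityˡ 1#) (*-identityʳ (- 1#))) (-‿inverseʳ 1#)
    a²·-1≈-a² : pow a 2 * pow (- 1#) 1 ≈ - (a * a)
    a²·-1≈-a² = trans (*-cong (*-congˡ (*-identityʳ a)) (*-identityʳ (- 1#)))
                      (trans (*-comm _ (- 1#)) (-1*x≈-x (a * a)))

  prodFin-negation : ∀ (φ : Carrier → Series) → (∀ {x y} → x ≈ y → φ x ≋ φ y) →
    ∀ {ζ N h} → pow ζ N ≈ 1# → pow ζ h ≈ - 1# →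
    prodFin N (λ k → φ (pow ζ k)) ≋ prodFin N (λ k → φ (- pow ζ k))
  prodFin-negation φ φ-cong {ζ} {N} {h} ζᴺ≈1 ζʰ≈-1 = ≋-sym (begin
    prodFin N (λ k → φ (- pow ζ k))         ≈⟨ prodFin-cong N (λ k _ → φ-cong (shift-by-h k)) ⟩
    prodFin N (λ k → φ (pow ζ (k ℕ.+ h)))   ≈⟨ prodFin-rotate N (λ k → φ (pow ζ k)) (λ k → φ-cong (periodic k)) h ⟩
    prodFin N (λ k → φ (pow ζ k))           ∎)
    where
    open ≋-Reasoning
    shift-by-h : ∀ k → - pow ζ k ≈ pow ζ (k ℕ.+ h)
    shift-by-h k = sym (trans (pow-+ ζ k h) (trans (*-congˡ ζʰ≈-1) (trans (*-comm _ (- 1#)) (-1*x≈-x _))))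
    periodic : ∀ k → pow ζ (k ℕ.+ N) ≈ pow ζ k
    periodic k = trans (pow-+ ζ k N) (trans (*-congˡ ζᴺ≈1) (*-identityʳ _))

  even⊎odd : ∀ n → 2 ∣ n ⊎ ∃[ m ] n ≡ suc (2 ℕ.* m)
  even⊎odd zero          = inj₁ (divides 0 ≡.refl)
  even⊎odd (suc zero)    = inj₂ (0 , ≡.refl)
  even⊎odd (suc (suc n)) with even⊎odd n
  ... | inj₁ (divides q ≡.refl) = inj₁ (divides (suc q) ≡.refl)
  ... | inj₂ (m , ≡.refl)       = inj₂ (suc m , ≡.cong suc (≡.sym (ℕP.*-suc 2 m)))

  ∤⇒odd-multiple : ∀ q n → ¬ 2 ^ suc q ∣ n → ∃[ h ] ∃[ m ] n ℕ.* h ≡ 2 ^ q ℕ.* suc (2 ℕ.* m)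
  ∤⇒odd-multiple q n 2ᑫ⁺¹∤n with even⊎odd n
  ... | inj₂ (m , ≡.refl) = 2 ^ q , m , ℕP.*-comm n (2 ^ q)
  ∤⇒odd-multiple zero     n 2∤n    | inj₁ 2∣n = contradiction 2∣n 2∤n
  ∤⇒odd-multiple (suc q) n 2ᑫ⁺²∤n | inj₁ (divides k ≡.refl) with ∤⇒odd-multiple q k 2ᑫ⁺¹∤k
    where
    2ᑫ⁺¹∤k : ¬ 2 ^ suc q ∣ k
    2ᑫ⁺¹∤k 2ᑫ⁺¹∣k = 2ᑫ⁺²∤n (≡.subst (_∣ k ℕ.* 2) (ℕP.*-comm (2 ^ suc q) 2) (*-monoˡ-∣ 2 2ᑫ⁺¹∣k))
  ... | h , m , kh≡2ᑫ·odd = h , m , (begin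
    k ℕ.* 2 ℕ.* h                  ≡⟨ ≡.cong (ℕ._* h) (ℕP.*-comm k 2) ⟩
    2 ℕ.* k ℕ.* h                  ≡⟨ ℕP.*-assoc 2 k h ⟩
    2 ℕ.* (k ℕ.* h)                ≡⟨ ≡.cong (2 ℕ.*_) kh≡2ᑫ·odd ⟩
    2 ℕ.* (2 ^ q ℕ.* suc (2 ℕ.* m)) ≡⟨ ℕP.*-assoc 2 (2 ^ q) _ ⟨
    2 ^ suc q ℕ.* suc (2 ℕ.* m)    ∎)
    where open ≡.≡-Reasoning

  -- Overpartition products

  ratio : Carrier → ℕ → Series
  ratio y n = onePlus y n ⊛ invOneMinus y n

  ratio-≋[]-one : ∀ y n → ratio y n ≋[ n ] one
  ratio-≋[]-one y n = ⊛-≋[]-one (binomial-≋[]-one _ n) (invOneMinus-≋[]-one y n)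

  onePlus-⊛-oneMinus : ∀ y {n} → 0 < n → onePlus y n ⊛ oneMinus y n ≋ oneMinus y (2 ℕ.* n)
  onePlus-⊛-oneMinus y {n} 0<n = ≋-trans (binomial-⊛-neg (pow y n) 0<n) (binomial-cong (2 ℕ.* n) (-‿cong (sym yⁿ⁺ⁿ)))
    where
    yⁿ⁺ⁿ : pow y (2 ℕ.* n) ≈ pow y n * pow y n
    yⁿ⁺ⁿ = trans (pow-+ y n (n ℕ.+ 0)) (*-congˡ (reflexive (≡.cong (pow y) (ℕP.+-identityʳ n))))

  ratio-as-quotient : ∀ y {n} → 0 < n → oneMinus y (2 ℕ.* n) ⊛ invOneMinus y n ^ˢ 2 ≋ ratio y n
  ratio-as-quotient y {n} 0<n = begin
    oneMinus y (2 ℕ.* n) ⊛ (I ⊛ (I ⊛ one))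
      ≈⟨ ⊛-congʳ (I ⊛ (I ⊛ one)) (onePlus-⊛-oneMinus y 0<n) ⟨
    (P ⊛ E) ⊛ (I ⊛ (I ⊛ one))
      ≈⟨ ⊛-solve 4 (λ p e i o → (p ⊕ e) ⊕ (i ⊕ (i ⊕ o)) ⊜ (p ⊕ i) ⊕ ((e ⊕ i) ⊕ o)) ≋-refl P E I one ⟩
    (P ⊛ I) ⊛ ((E ⊛ I) ⊛ one)
      ≈⟨ ⊛-congˡ (P ⊛ I) (≋-trans (⊛-identityʳ (E ⊛ I)) (oneMinus-invOneMinus y 0<n)) ⟩
    (P ⊛ I) ⊛ one
      ≈⟨ ⊛-identityʳ (P ⊛ I) ⟩
    ratio y n
      ∎
    where
    open ≋-Reasoning
    P = onePlus y n
    E = oneMinus y n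
    I = invOneMinus y n

  -- The generating function Π_{j≥1} (1 + q^j)/(1 − q^j) of overpartitions, at q = x^m.
  overpartitions : ℕ → Series
  overpartitions m = prodInf (λ j → ratio 1# (m ℕ.* j))

  0<m*[1+j] : ∀ {m} j → 0 < m → 0 < m ℕ.* suc j
  0<m*[1+j] j 0<m = ℕP.*-mono-< 0<m (s≤s z≤n)

  poch-admissible : ∀ {m} → 0 < m → Admissible (λ j → oneMinus 1# (m ℕ.* j))
  poch-admissible {m} 0<m = admissible-scaled m 0<m (λ n → binomial-≋[]-one (- pow 1# n) n)

  pochInv-admissible : ∀ {m} → 0 < m → Admissible (λ j → invOneMinus 1# (m ℕ.* j))
  pochInv-admissible {m} 0<m = admissible-scaled m 0<m (invOneMinus-≋[]-one 1#)

  overpartitions-poch : ∀ {m} → 0 < m → poch (m ℕ.* 2) ⊛ pochInv m ^ˢ 2 ≋ overpartitions m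
  overpartitions-poch {m} 0<m = begin
    poch (m ℕ.* 2) ⊛ pochInv m ^ˢ 2
      ≈⟨ ⊛-congˡ (poch (m ℕ.* 2)) (prodInf-^ˢ (pochInv-admissible 0<m) 2) ⟩
    poch (m ℕ.* 2) ⊛ prodInf (λ j → invOneMinus 1# (m ℕ.* j) ^ˢ 2)
      ≈⟨ prodInf-⊛ (poch-admissible (ℕP.*-mono-< 0<m (s≤s z≤n))) (admissible-^ˢ 2 (pochInv-admissible 0<m)) ⟩
    prodInf (λ j → oneMinus 1# (m ℕ.* 2 ℕ.* j) ⊛ invOneMinus 1# (m ℕ.* j) ^ˢ 2)
      ≈⟨ prodInf-cong (λ j → ≋-trans
           (⊛-congʳ (invOneMinus 1# (m ℕ.* suc j) ^ˢ 2) (≡⇒≋ (≡.cong (oneMinus 1#) (m*2*j≡2*[m*j] (suc j)))))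
           (ratio-as-quotient 1# (0<m*[1+j] j 0<m))) ⟩
    overpartitions m
        ∎
    where
    open ≋-Reasoning
    m*2*j≡2*[m*j] : ∀ j → m ℕ.* 2 ℕ.* j ≡ 2 ℕ.* (m ℕ.* j)
    m*2*j≡2*[m*j] j = ≡.trans (≡.cong (ℕ._* j) (ℕP.*-comm m 2)) (ℕP.*-assoc 2 m j)

  poch-pochInv : ∀ {m} → 0 < m → poch m ⊛ pochInv m ≋ one
  poch-pochInv 0<m = ≋-trans (prodInf-⊛ (poch-admissible 0<m) (pochInv-admissible 0<m))
    (≋-trans (prodInf-cong (λ j → oneMinus-invOneMinus 1# (0<m*[1+j] j 0<m))) prodInf-one)

  overpartitions-inverse : ∀ {m} → 0 < m → overpartitions m ⊛ (poch m ^ˢ 2 ⊛ pochInv (m ℕ.* 2)) ≋ one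
  overpartitions-inverse {m} 0<m = begin
    overpartitions m ⊛ (poch m ^ˢ 2 ⊛ pochInv (m ℕ.* 2))
      ≈⟨ ⊛-congʳ (poch m ^ˢ 2 ⊛ pochInv (m ℕ.* 2)) (overpartitions-poch 0<m) ⟨
    (poch (m ℕ.* 2) ⊛ pochInv m ^ˢ 2) ⊛ (poch m ^ˢ 2 ⊛ pochInv (m ℕ.* 2))
      ≈⟨ ⊛-solve 4 (λ a b c d → (a ⊕ b) ⊕ (c ⊕ d) ⊜ (a ⊕ d) ⊕ (c ⊕ b)) ≋-refl
                   (poch (m ℕ.* 2)) (pochInv m ^ˢ 2) (poch m ^ˢ 2) (pochInv (m ℕ.* 2)) ⟩
    (poch (m ℕ.* 2) ⊛ pochInv (m ℕ.* 2)) ⊛ (poch m ^ˢ 2 ⊛ pochInv m ^ˢ 2)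
      ≈⟨ ⊛-cong (poch-pochInv 2m>0) (≋-trans (≋-sym (^ˢ-distrib-⊛ (poch m) (pochInv m) 2))
                                            (≋-trans (^ˢ-cong 2 (poch-pochInv 0<m)) (one-^ˢ 2))) ⟩
    one ⊛ one
      ≈⟨ ⊛-identityʳ one ⟩
    one
      ∎
    where
    open ≋-Reasoning
    2m>0 : 0 < m ℕ.* 2
    2m>0 = ℕP.*-mono-< 0<m (s≤s z≤n)

  -- The left-hand side

  lhsFactor : Carrier → ℕ → ℕ → Series
  lhsFactor ω r n = prodFin r (λ k → ratio (pow ω k) n)

  lhsFactor-admissible : ∀ ω r → Admissible (lhsFactor ω r)
  lhsFactor-admissible ω r n = prodFin-≋[]-one r _ (λ k → ratio-≋[]-one (pow ω k) n)

  lhs≋prodInf-lhsFactor : ∀ ω r → lhs r ω ≋ prodInf (lhsFactor ω r)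
  lhs≋prodInf-lhsFactor ω r = prodFin-prodInf r (λ k n → ratio (pow ω k) n) (λ k n → ratio-≋[]-one (pow ω k) n)

  module Conjugates (ω : Carrier) (n : ℕ) where

    numerator denominator inverse : ℕ → Series
    numerator   r = prodFin r (λ k → onePlus (pow ω k) n)
    denominator r = prodFin r (λ k → oneMinus (pow ω k) n)
    inverse     r = prodFin r (λ k → invOneMinus (pow ω k) n)

    ζ : Carrier
    ζ = pow ω n

    numerator-ζ : ∀ r {f : ℕ → Carrier} → (∀ k → pow ζ k ≈ f k) → numerator r ≋ prodFin r (λ k → binomial (f k) n)
    numerator-ζ r ζᵏ≈ = prodFin-cong r (λ k _ → binomial-cong n (trans (pow-comm ω k n) (ζᵏ≈ k)))

    denominator-ζ : ∀ r {f : ℕ → Carrier} → (∀ k → - pow ζ k ≈ f k) → denominator r ≋ prodFin r (λ k → binomial (f k) n)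
    denominator-ζ r ζᵏ≈ = prodFin-cong r (λ k _ → binomial-cong n (trans (-‿cong (pow-comm ω k n)) (ζᵏ≈ k)))

    denominator⊛inverse : ∀ r → 0 < n → denominator r ⊛ inverse r ≋ one
    denominator⊛inverse r 0<n = begin
      denominator r ⊛ inverse r
        ≈⟨ prodFin-⊛ r (λ k → oneMinus (pow ω k) n) (λ k → invOneMinus (pow ω k) n) ⟨
      prodFin r (λ k → oneMinus (pow ω k) n ⊛ invOneMinus (pow ω k) n)
        ≈⟨ prodFin-cong r (λ k _ → oneMinus-invOneMinus (pow ω k) 0<n) ⟩
      prodFin r (λ _ → one)
        ≈⟨ prodFin-const r one ⟩
      one ^ˢ r
        ≈⟨ one-^ˢ r ⟩
      one
        ∎
      where open ≋-Reasoning

    lhsFactor-quotient : ∀ r → 0 < n → ∀ Y Z → denominator r ≋ Y → Y ⊛ Z ≋ one → lhsFactor ω r n ≋ numerator r ⊛ Z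
    lhsFactor-quotient r 0<n Y Z denominator≋Y Y⊛Z≋one = ≋-trans (prodFin-⊛ r _ _)
      (⊛-congˡ (numerator r) (⊛-inverse-unique Y (inverse r) Z
        (≋-trans (⊛-congʳ (inverse r) (≋-sym denominator≋Y)) (denominator⊛inverse r 0<n)) Y⊛Z≋one))

    lhsFactor-∣ : ∀ {r} → 0 < n → pow ω r ≈ 1# → r ∣ n → lhsFactor ω r n ≋ ratio 1# n ^ˢ r
    lhsFactor-∣ {r} 0<n ωʳ≈1 (divides q ≡.refl) = begin
      lhsFactor ω r n
        ≈⟨ lhsFactor-quotient r 0<n (oneMinus 1# n ^ˢ r) (invOneMinus 1# n ^ˢ r)
             (≋-trans (denominator-ζ r {λ _ → - pow 1# n} (λ k → -‿cong (ζᵏ≈1ⁿ k))) (prodFin-const r (oneMinus 1# n)))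
             (≋-trans (≋-sym (^ˢ-distrib-⊛ (oneMinus 1# n) (invOneMinus 1# n) r))
                      (≋-trans (^ˢ-cong r (oneMinus-invOneMinus 1# 0<n)) (one-^ˢ r))) ⟩
      numerator r ⊛ invOneMinus 1# n ^ˢ r
        ≈⟨ ⊛-congʳ (invOneMinus 1# n ^ˢ r)
             (≋-trans (numerator-ζ r {λ _ → pow 1# n} ζᵏ≈1ⁿ) (prodFin-const r (onePlus 1# n))) ⟩
      onePlus 1# n ^ˢ r ⊛ invOneMinus 1# n ^ˢ r
        ≈⟨ ^ˢ-distrib-⊛ (onePlus 1# n) (invOneMinus 1# n) r ⟨
      ratio 1# n ^ˢ r
          ∎
      where
      open ≋-Reasoning
      ζ≈1 : ζ ≈ 1#
      ζ≈1 = ≡.subst (λ t → pow ω t ≈ 1#) (ℕP.*-comm r q) (pow-root-of-unity {ω} {r} ωʳ≈1 q)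
      ζᵏ≈1ⁿ : ∀ k → pow ζ k ≈ pow 1# n
      ζᵏ≈1ⁿ k = trans (pow-cong k ζ≈1) (trans (pow-1# k) (sym (pow-1# n)))

    lhsFactor-oddPrime : ∀ {r h} → Prime r → r ≡ suc (2 ℕ.* h) → geom ω r ≈ 0# → ¬ r ∣ n → 0 < n →
      lhsFactor ω r n ≋ ratio 1# (r ℕ.* n)
    lhsFactor-oddPrime {r} {h} pr r≡2h+1 [r]ω≈0 r∤n 0<n = begin
      lhsFactor ω r n
        ≈⟨ lhsFactor-quotient r 0<n (oneMinus 1# (r ℕ.* n)) (invOneMinus 1# (r ℕ.* n))
             (≋-trans (denominator-ζ r (λ k → sym (-1*x≈-x _)))
                      (cyclotomic (- 1#) (trans (*-cong -1ʳ≈-1 ζ^tri≈1) (trans (*-identityʳ _) (-‿cong (sym 1ʳⁿ≈1))))))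
             (oneMinus-invOneMinus 1# 0<rn) ⟩
      numerator r ⊛ invOneMinus 1# (r ℕ.* n)
        ≈⟨ ⊛-congʳ (invOneMinus 1# (r ℕ.* n))
             (≋-trans (numerator-ζ r (λ k → sym (*-identityˡ _)))
                      (cyclotomic 1# (trans (*-cong (pow-1# r) ζ^tri≈1) (trans (*-identityʳ 1#) (sym 1ʳⁿ≈1))))) ⟩
      ratio 1# (r ℕ.* n)
          ∎
      where
      open ≋-Reasoning
      0<rn : 0 < r ℕ.* n
      0<rn = ℕP.*-mono-< (prime⇒pos pr) 0<n
      [r]ζ≈0 : geom ζ r ≈ 0#
      [r]ζ≈0 = geom-pow-root n pr [r]ω≈0 r∤n
      ζ^tri≈1 : pow ζ (tri r) ≈ 1#
      ζ^tri≈1 = pow-tri-odd {ζ} {r} {h} r≡2h+1 (geom≈0⇒pow≈1 {ζ} {r} [r]ζ≈0)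
      1ʳⁿ≈1 : pow 1# (r ℕ.* n) ≈ 1#
      1ʳⁿ≈1 = pow-1# (r ℕ.* n)
      -1ʳ≈-1 : pow (- 1#) r ≈ - 1#
      -1ʳ≈-1 = ≡.subst (λ t → pow (- 1#) t ≈ - 1#) (≡.sym r≡2h+1) (pow-neg-one-odd h)
      cyclotomic : ∀ a {c} → pow a r * pow ζ (tri r) ≈ c →
        prodFin r (λ k → binomial (a * pow ζ k) n) ≋ binomial c (r ℕ.* n)
      cyclotomic a eq = ≋-trans (prodFin-binomial-root a 0<n pr [r]ζ≈0) (binomial-cong (r ℕ.* n) eq)

    lhsFactor-2^ : ∀ q → pow ω (2 ^ q) ≈ - 1# → ¬ 2 ^ suc q ∣ n → lhsFactor ω (2 ^ suc q) n ≋ one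
    lhsFactor-2^ q ω²ᑫ≈-1 r∤n with ∤⇒odd-multiple q n r∤n
    ... | h , m , nh≡2ᑫ[2m+1] =
      ≋-trans (prodFin-⊛ r _ _) (≋-trans (⊛-congʳ (inverse r) numerator≋denominator) (denominator⊛inverse r 0<n))
      where
      open ≈-Reasoning
      r = 2 ^ suc q
      0<n : 0 < n
      0<n = ℕP.n≢0⇒n>0 (λ { ≡.refl → r∤n (r ∣0) })
      ζʳ≈1 : pow ζ r ≈ 1#
      ζʳ≈1 = trans (pow-comm ω n r) (trans (pow-cong n (pow-2^-root q ω²ᑫ≈-1)) (pow-1# n))
      ζʰ≈-1 : pow ζ h ≈ - 1#
      ζʰ≈-1 = begin
        pow (pow ω n) h                        ≈⟨ pow-* ω n h ⟨
        pow ω (n ℕ.* h)                        ≡⟨ ≡.cong (pow ω) nh≡2ᑫ[2m+1] ⟩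
        pow ω (2 ^ q ℕ.* suc (2 ℕ.* m))        ≈⟨ pow-* ω (2 ^ q) _ ⟩
        pow (pow ω (2 ^ q)) (suc (2 ℕ.* m))    ≈⟨ pow-cong (suc (2 ℕ.* m)) ω²ᑫ≈-1 ⟩
        pow (- 1#) (suc (2 ℕ.* m))             ≈⟨ pow-neg-one-odd m ⟩
        - 1#                                   ∎
      numerator≋denominator : numerator r ≋ denominator r
      numerator≋denominator = ≋-trans (numerator-ζ r (λ k → refl))
        (≋-trans (prodFin-negation (λ c → binomial c n) (binomial-cong n) {ζ} {r} {h} ζʳ≈1 ζʰ≈-1)
                 (≋-sym (denominator-ζ r (λ k → refl))))

  prodInf-lhsFactor-multiples : ∀ {ω r} → 0 < r → pow ω r ≈ 1# →
    prodInf (λ m → lhsFactor ω r (r ℕ.* m)) ≋ overpartitions r ^ˢ r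
  prodInf-lhsFactor-multiples {ω} {r} 0<r ωʳ≈1 = ≋-trans
    (prodInf-cong (λ m → Conjugates.lhsFactor-∣ ω (r ℕ.* suc m) {r} (0<m*[1+j] m 0<r) ωʳ≈1 (m∣m*n (suc m))))
    (≋-sym (prodInf-^ˢ (admissible-scaled r 0<r (ratio-≋[]-one 1#)) r))

  prodInf-lhsFactor-oddPrime : ∀ {ω r h} → Prime r → r ≡ suc (2 ℕ.* h) → geom ω r ≈ 0# →
    prodInf (lhsFactor ω r) ⊛ overpartitions (r ℕ.* r) ≋ overpartitions r ^ˢ suc r
  prodInf-lhsFactor-oddPrime {ω} {r} {h} pr r≡2h+1 [r]≈0 = begin
    prodInf G ⊛ overpartitions (r ℕ.* r)
      ≈⟨ ⊛-cong (prodInf-split 0<r (lhsFactor-admissible ω r))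
                (prodInf-cong (λ m → ≡⇒≋ (≡.cong (ratio 1#) (ℕP.*-assoc r r (suc m))))) ⟩
    (prodInf (offMultiples r G) ⊛ prodInf (λ m → G (r ℕ.* m))) ⊛ prodInf (λ m → H (r ℕ.* m))
      ≈⟨ ⊛-congʳ (prodInf (λ m → H (r ℕ.* m)))
           (⊛-cong (prodInf-cong (λ n → off-G≋off-H (r ∣? suc n))) (prodInf-lhsFactor-multiples 0<r ωʳ≈1)) ⟩
    (prodInf (offMultiples r H) ⊛ overpartitions r ^ˢ r) ⊛ prodInf (λ m → H (r ℕ.* m))
      ≈⟨ ⊛-solve 3 (λ a b c → (a ⊕ b) ⊕ c ⊜ (a ⊕ c) ⊕ b) ≋-refl
           (prodInf (offMultiples r H)) (overpartitions r ^ˢ r) (prodInf (λ m → H (r ℕ.* m))) ⟩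
    (prodInf (offMultiples r H) ⊛ prodInf (λ m → H (r ℕ.* m))) ⊛ overpartitions r ^ˢ r
      ≈⟨ ⊛-congʳ (overpartitions r ^ˢ r) (prodInf-split 0<r (admissible-scaled r 0<r (ratio-≋[]-one 1#))) ⟨
    overpartitions r ⊛ overpartitions r ^ˢ r
        ∎
    where
    open ≋-Reasoning
    G H : ℕ → Series
    G = lhsFactor ω r
    H j = ratio 1# (r ℕ.* j)
    0<r : 0 < r
    0<r = prime⇒pos pr
    ωʳ≈1 : pow ω r ≈ 1#
    ωʳ≈1 = geom≈0⇒pow≈1 {ω} {r} [r]≈0
    off-G≋off-H : ∀ {n} (d : Dec (r ∣ suc n)) → dropIf d (G (suc n)) ≋ dropIf d (H (suc n))
    off-G≋off-H     (yes _)  = ≋-refl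
    off-G≋off-H {n} (no r∤n) = Conjugates.lhsFactor-oddPrime ω (suc n) {r} {h} pr r≡2h+1 [r]≈0 r∤n (s≤s z≤n)

  lhs-oddPrime : ∀ {ω r} → Prime r → ¬ 2 ∣ r → geom ω r ≈ 0# →
    lhs r ω ≋ poch (r ℕ.* 2) ^ˢ (r ℕ.+ 1) ⊛ poch (r ℕ.* r) ^ˢ 2
              ⊛ pochInv r ^ˢ (2 ℕ.* r ℕ.+ 2) ⊛ pochInv (r ℕ.* (2 ℕ.* r))
  lhs-oddPrime {ω} {r} pr 2∤r [r]≈0 with even⊎odd r
  ... | inj₁ 2∣r            = contradiction 2∣r 2∤r
  ... | inj₂ (h , r≡2h+1)   = begin
    lhs r ω
      ≈⟨ lhs≋prodInf-lhsFactor ω r ⟩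
    prodInf G
      ≈⟨ ⊛-insertʳ {a = overpartitions (r ℕ.* r)} {c = K} (overpartitions-inverse 0<r²) (prodInf G) ⟩
    (prodInf G ⊛ overpartitions (r ℕ.* r)) ⊛ K
      ≈⟨ ⊛-congʳ K (prodInf-lhsFactor-oddPrime {ω} {r} {h} pr r≡2h+1 [r]≈0) ⟩
    overpartitions r ^ˢ suc r ⊛ K
      ≈⟨ ⊛-congʳ K (^ˢ-cong (suc r) (overpartitions-poch 0<r)) ⟨
    (A ⊛ B ^ˢ 2) ^ˢ suc r ⊛ K
      ≈⟨ ⊛-congʳ K (^ˢ-distrib-⊛ A (B ^ˢ 2) (suc r)) ⟩
    (A ^ˢ suc r ⊛ (B ^ˢ 2) ^ˢ suc r) ⊛ K
      ≈⟨ ⊛-congʳ K (⊛-congˡ (A ^ˢ suc r) (^ˢ-* B (suc r) 2)) ⟨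
    (A ^ˢ suc r ⊛ B ^ˢ (suc r ℕ.* 2)) ⊛ (C ^ˢ 2 ⊛ pochInv (r ℕ.* r ℕ.* 2))
      ≡⟨ ≡.cong₂ (λ s t → (A ^ˢ s ⊛ B ^ˢ t) ⊛ (C ^ˢ 2 ⊛ pochInv (r ℕ.* r ℕ.* 2))) (ℕP.+-comm 1 r) (exponent r) ⟩
    (A ^ˢ (r ℕ.+ 1) ⊛ B ^ˢ (2 ℕ.* r ℕ.+ 2)) ⊛ (C ^ˢ 2 ⊛ pochInv (r ℕ.* r ℕ.* 2))
      ≡⟨ ≡.cong (λ t → (A ^ˢ (r ℕ.+ 1) ⊛ B ^ˢ (2 ℕ.* r ℕ.+ 2)) ⊛ (C ^ˢ 2 ⊛ pochInv t)) (index r) ⟩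
    (A ^ˢ (r ℕ.+ 1) ⊛ B ^ˢ (2 ℕ.* r ℕ.+ 2)) ⊛ (C ^ˢ 2 ⊛ D)
      ≈⟨ ⊛-solve 4 (λ a b c d → (a ⊕ b) ⊕ (c ⊕ d) ⊜ ((a ⊕ c) ⊕ b) ⊕ d) ≋-refl
                   (A ^ˢ (r ℕ.+ 1)) (B ^ˢ (2 ℕ.* r ℕ.+ 2)) (C ^ˢ 2) D ⟩
    A ^ˢ (r ℕ.+ 1) ⊛ C ^ˢ 2 ⊛ B ^ˢ (2 ℕ.* r ℕ.+ 2) ⊛ D
        ∎
    where
    open ≋-Reasoning
    G = lhsFactor ω r
    A = poch (r ℕ.* 2)
    B = pochInv r
    C = poch (r ℕ.* r)
    D = pochInv (r ℕ.* (2 ℕ.* r))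
    K = C ^ˢ 2 ⊛ pochInv (r ℕ.* r ℕ.* 2)
    0<r : 0 < r
    0<r = prime⇒pos pr
    0<r² : 0 < r ℕ.* r
    0<r² = ℕP.*-mono-< 0<r 0<r
    exponent : ∀ r → suc r ℕ.* 2 ≡ 2 ℕ.* r ℕ.+ 2
    exponent = solve-∀
    index : ∀ r → r ℕ.* r ℕ.* 2 ≡ r ℕ.* (2 ℕ.* r)
    index = solve-∀

  cycRootPow2⇒root : ∀ {ω} p → CycRootPow2 p ω → pow ω (2 ^ p) ≈ 1#
  cycRootPow2⇒root {ω} zero    ω≈1    = trans (*-identityʳ ω) ω≈1
  cycRootPow2⇒root     (suc q) ω²ᑫ≈-1 = pow-2^-root q ω²ᑫ≈-1

  lhsFactor-cycRootPow2 : ∀ {ω} p → CycRootPow2 p ω → ∀ {n} → ¬ 2 ^ p ∣ n → lhsFactor ω (2 ^ p) n ≋ one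
  lhsFactor-cycRootPow2     zero    _      {n} 1∤n = contradiction (1∣ n) 1∤n
  lhsFactor-cycRootPow2 {ω} (suc q) ω²ᑫ≈-1 {n} r∤n = Conjugates.lhsFactor-2^ ω n q ω²ᑫ≈-1 r∤n

  lhs-pow2 : ∀ {ω} p → CycRootPow2 p ω →
    lhs (2 ^ p) ω ≋ poch (2 ^ p ℕ.* 2) ^ˢ (2 ^ p) ⊛ pochInv (2 ^ p) ^ˢ (2 ℕ.* 2 ^ p)
  lhs-pow2 {ω} p cyc = begin
    lhs r ω
      ≈⟨ lhs≋prodInf-lhsFactor ω r ⟩
    prodInf G
      ≈⟨ prodInf-split 0<r (lhsFactor-admissible ω r) ⟩
    prodInf (offMultiples r G) ⊛ prodInf (λ m → G (r ℕ.* m))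
      ≈⟨ ⊛-cong (≋-trans (prodInf-cong (λ n → off-G≋one (r ∣? suc n))) prodInf-one)
                (prodInf-lhsFactor-multiples 0<r (cycRootPow2⇒root p cyc)) ⟩
    one ⊛ overpartitions r ^ˢ r
      ≈⟨ ⊛-identityˡ (overpartitions r ^ˢ r) ⟩
    overpartitions r ^ˢ r
      ≈⟨ ^ˢ-cong r (overpartitions-poch 0<r) ⟨
    (A ⊛ B ^ˢ 2) ^ˢ r
      ≈⟨ ^ˢ-distrib-⊛ A (B ^ˢ 2) r ⟩
    A ^ˢ r ⊛ (B ^ˢ 2) ^ˢ r
      ≈⟨ ⊛-congˡ (A ^ˢ r) (^ˢ-* B r 2) ⟨
    A ^ˢ r ⊛ B ^ˢ (r ℕ.* 2)
      ≡⟨ ≡.cong (λ t → A ^ˢ r ⊛ B ^ˢ t) (ℕP.*-comm r 2) ⟩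
    A ^ˢ r ⊛ B ^ˢ (2 ℕ.* r)
      ∎
    where
    open ≋-Reasoning
    r = 2 ^ p
    G = lhsFactor ω r
    A = poch (r ℕ.* 2)
    B = pochInv r
    0<r : 0 < r
    0<r = ℕP.n≢0⇒n>0 (λ 2ᵖ≡0 → contradiction (ℕP.m^n≡0⇒m≡0 2 p 2ᵖ≡0) (λ ()))
    off-G≋one : ∀ {n} (d : Dec (r ∣ n)) → dropIf d (G n) ≋ one
    off-G≋one     (yes _)  = ≋-refl
    off-G≋one {n} (no r∤n) = lhsFactor-cycRootPow2 p cyc r∤n

open import Level using (Level)
open import Data.Nat using (_+_; _*_)
open import Data.Product using (_×_)

lemma13 : ∀ {c ℓ : Level} (R : CommutativeRing c ℓ) (r : ℕ) (ω : CommutativeRing.Carrier R) →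
    let open PS R in
    (Prime r → ¬ (2 ∣ r) → CycRootPrime r ω →
      lhs r ω ≈ˢ ((poch (r * 2) ^ˢ (r + 1)) ⊛ (poch (r * r) ^ˢ 2)
                   ⊛ (pochInv r ^ˢ (2 * r + 2)) ⊛ pochInv (r * (2 * r))))
    ×
    (∀ (p : ℕ) → r ≡ 2 ^ p → CycRootPow2 p ω →
      lhs r ω ≈ˢ ((poch (r * 2) ^ˢ r) ⊛ (pochInv r ^ˢ (2 * r))))
lemma13 R r ω = (λ pr 2∤r cyc → coeff (lhs-oddPrime pr 2∤r cyc)) , pow2
  where
  open PowerSeriesProducts R
  open PS R using (CycRootPow2)
  pow2 : ∀ p → r ≡ 2 ^ p → CycRootPow2 p ω → _
  pow2 p ≡.refl cyc = coeff (lhs-pow2 p cyc)
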